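{- Let $d \geq 2$ be an integer and $T$ a tree of order $n$ with $\ell$ leaves. If $n-\ell \geq d$, then $\gamma_d(T) \leq \frac{n-\ell}{d}$, with equality if and only if $T \in \mathcal{F}_d'$.
   Context: $\gamma_d(G)$ is the minimum size of a set $S\subseteq V(G)$ such that every vertex not in $S$ is at distance at most $d$ from some vertex of $S$. $L(T)$ is the set of leaves of $T$; $P_k$ is the path on $k$ vertices. For $k\ge 1$, $T^*\circ P_k$ is obtained from $T^*$ by attaching to each vertex $v$ of $T^*$ its own new copy of $P_k$ via an edge from $v$ to an end vertex of the copy, and $\mathcal{T}_k=\{T^*\circ P_k: T^*\text{ a tree with at least two vertices}\}$. Define $\mathcal{F}_2'=\{T\text{ tree}: T-L(T)\in\{K_2\}\cup\mathcal{T}_1\}$ and, for $d\ge3$, $\mathcal{F}_d'=\{T\text{ tree}: T-L(T)\text{ is a tree of order } d \text{ or belongs to }\mathcal{T}_{d-1}\}$. -}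

module Defs where

open import Data.Nat using (ℕ; zero; suc; _≤_; _∸_; _≡ᵇ_)
open import Data.Nat.ListAction using (sum)
open import Data.Bool using (Bool; true; false; if_then_else_; _∧_; _∨_; not)
open import Data.Fin using (Fin; toℕ; _≟_)
open import Data.Fin.Subset using (Subset; _∈_; _∉_; ∣_∣)
open import Data.List using (List; []; _∷_; map)
open import Data.List.Base using (allFin)
open import Data.List.Relation.Unary.Unique.Propositional using (Unique)
open import Data.Product using (Σ; ∃; _×_; _,_)
open import Data.Sum using (_⊎_)
open import Relation.Binary.PropositionalEquality using (_≡_)
open import Relation.Nullary using (¬_; ⌊_⌋)

record Graph : Set where
  field
    order      : ℕ
    adj        : Fin order → Fin order → Bool
    adj-sym    : ∀ u v → adj u v ≡ adj v u
    adj-irrefl : ∀ v → adj v v ≡ false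
open Graph public

module _ (G : Graph) where

  deg : Fin (order G) → ℕ
  deg v = sum (map (λ u → if adj G v u then 1 else 0) (allFin (order G)))

  IsLeaf : Fin (order G) → Set
  IsLeaf v = deg v ≡ 1

  NonLeaf : Fin (order G) → Set
  NonLeaf v = ¬ IsLeaf v

  numLeaves : ℕ
  numLeaves = sum (map (λ v → if deg v ≡ᵇ 1 then 1 else 0) (allFin (order G)))

  data Walk : Fin (order G) → Fin (order G) → ℕ → Set where
    here : ∀ {v} → Walk v v 0
    step : ∀ {u w v k} → adj G u w ≡ true → Walk w v k → Walk u v (suc k)

  walkVerts : ∀ {u v k} → Walk u v k → List (Fin (order G))
  walkVerts {v = v} here = v ∷ []
  walkVerts {u = u} (step _ w) = u ∷ walkVerts w

  Connected : Set
  Connected = ∀ u v → ∃ λ k → Walk u v k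

  HasCycle : Set
  HasCycle = Σ (Fin (order G)) λ u → Σ (Fin (order G)) λ v → Σ ℕ λ k →
             Σ (Walk u v k) λ w → (2 ≤ k) × (adj G v u ≡ true) × Unique (walkVerts w)

  IsTree : Set
  IsTree = Connected × ¬ HasCycle

  DistDominating : ℕ → Subset (order G) → Set
  DistDominating d S = ∀ v → v ∉ S → Σ (Fin (order G)) λ u → u ∈ S × (∃ λ k → k ≤ d × Walk u v k)

  IsDistDomNumber : ℕ → ℕ → Set
  IsDistDomNumber d γ =
    (∃ λ S → DistDominating d S × ∣ S ∣ ≡ γ) × (∀ S → DistDominating d S → γ ≤ ∣ S ∣)

InducedIso : {A : Set} → (A → A → Bool) → (G : Graph) → (Fin (order G) → Set) → Set
InducedIso {A} adjA G P =
  Σ (A → Fin (order G)) λ f →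
    (∀ a b → f a ≡ f b → a ≡ b) ×
    (∀ a → P (f a)) ×
    (∀ v → P v → ∃ λ a → f a ≡ v) ×
    (∀ a b → adjA a b ≡ adj G (f a) (f b))

K2adj : Fin 2 → Fin 2 → Bool
K2adj a b = not ⌊ a ≟ b ⌋

-- T* ∘ P_k on vertex set V(T*) × {0,…,k}: (v,0) is v, (v,1),…,(v,k) is the attached copy of P_k
coronaAdj : (T* : Graph) → (k : ℕ) → (Fin (order T*) × Fin (suc k)) → (Fin (order T*) × Fin (suc k)) → Bool
coronaAdj T* k (v , Fin.zero) (w , Fin.zero) = adj T* v w
coronaAdj T* k (v , i) (w , j) =
  ⌊ v ≟ w ⌋ ∧ ((suc (toℕ i) ≡ᵇ toℕ j) ∨ (suc (toℕ j) ≡ᵇ toℕ i))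

InTk : ℕ → (G : Graph) → (Fin (order G) → Set) → Set
InTk k G P = Σ Graph λ T* → (2 ≤ order T*) × IsTree T* × InducedIso (coronaAdj T* k) G P

InFd' : ℕ → Graph → Set
InFd' 2 T = InducedIso K2adj T (NonLeaf T) ⊎ InTk 1 T (NonLeaf T)
InFd' d T = (Σ Graph λ H → (order H ≡ d) × IsTree H × InducedIso (adj H) T (NonLeaf T))
            ⊎ InTk (d ∸ 1) T (NonLeaf T)

module Submission where

-- Let k = d − 1 and h = n − ℓ, the number of non-leaves. The non-leaves form a subtree; root T at one of them.
-- Every leaf hangs on a non-leaf, so centres that reach every non-leaf within distance k reach all of T within d.
-- For an ancestor-closed vertex set P with |P| ≥ k + 1 such centres C with (k + 1)|C| ≤ |P| are built by strong
-- induction on |P|: for a deepest x ∈ P with k-th ancestor u, the subtree below u has at least k + 1 vertices and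
-- lies within distance k of u, so u is added and the induction continues on the rest (which, if it has at most
-- k + 1 vertices, is reached from u or from the parent of u instead). Tracking the equality case through this
-- construction shows that (k + 1)|C| = |P| forces P to induce a tree of order k + 1 or a corona T* ∘ P_k.
-- Conversely, in T* ∘ P_k the tip of each pendant path carries a leaf, and no walk of length at most d from that
-- leaf leaves its pendant path, so every distance-d dominating set has at least |T*| = h / d vertices; when the
-- non-leaves form a tree of order d, h = d ≤ dγ holds trivially.

open import Defs
open import Data.Bool using (Bool; true; false; T; if_then_else_; _∧_; _∨_; not)
open import Data.Bool.Properties using (∨-zeroʳ; ∨-comm; ∧-conicalˡ; ∧-conicalʳ; ¬-not; not-involutive)
  renaming (_≟_ to _≟ᵇ_)
open import Data.Empty using (⊥; ⊥-elim)
open import Data.Fin using (Fin; zero; suc; toℕ; _≟_)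
open import Data.Fin.Properties using (any?; toℕ-injective; toℕ≤pred[n])
import Data.Fin.Properties
open import Data.Fin.Subset using (Subset; ∣_∣) renaming (_∈_ to _∈ₛ_)
open import Data.Fin.Subset.Properties using () renaming (_∈?_ to _∈ₛ?_)
open import Data.List using (List; []; _∷_; length; map; filter; lookup; allFin; tabulate; cartesianProduct)
open import Data.List.Extrema.Nat using (argmax; argmax-all; f[xs]≤f[argmax])
open import Data.List.Properties using (map-tabulate; length-map; length-++; length-tabulate)
open import Data.List.Membership.Propositional using (_∈_; _∉_)
open import Data.List.Membership.Propositional.Properties
  using (∈-map⁺; ∈-map⁻; ∈-allFin; ∈-filter⁺; ∈-filter⁻; ∈-lookup; ∈-cartesianProduct⁺)
import Data.List.Relation.Unary.All as All
open import Data.List.Relation.Unary.All using ([]; _∷_)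
open import Data.List.Relation.Unary.All.Properties using (¬Any⇒All¬; All¬⇒¬Any)
import Data.List.Relation.Unary.Any as Any
open import Data.List.Relation.Unary.Any using (here; there; index)
open import Data.List.Relation.Unary.Any.Properties using (lookup-index)
open import Data.List.Relation.Unary.AllPairs using ([]; _∷_)
open import Data.List.Relation.Unary.Unique.Propositional using (Unique)
open import Data.List.Relation.Unary.Unique.Propositional.Properties using (map⁺; filter⁺; allFin⁺; cartesianProduct⁺)
open import Data.Nat using (ℕ; zero; suc; pred; _+_; _*_; _∸_; _≤_; _<_; z≤n; s≤s; _≤?_; _<?_; _≡ᵇ_; _≤ᵇ_)
  renaming (_≟_ to _≟ℕ_)
open import Data.Nat.ListAction using (sum)
open import Data.Nat.Properties hiding (_≟_)
open import Data.Product using (Σ; ∃; _×_; _,_; proj₁; proj₂)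
open import Data.Sum using (_⊎_; inj₁; inj₂)
import Data.Vec as Vec
open import Data.Vec.Properties using ([]=⇒lookup; lookup⇒[]=; lookup∘tabulate)
open import Function using (_∘_)
open import Function.Bundles using (_⇔_; mk⇔)
open import Function.Construct.Composition using (_⇔-∘_)
import Function.Properties.Equivalence
open import Relation.Binary using (tri<; tri≈; tri>)
open import Relation.Binary.PropositionalEquality
open import Relation.Nullary using (¬_; Dec; yes; no; ⌊_⌋; ¬?; _×-dec_)
open import Relation.Nullary.Decidable using (dec-true; dec-false; isYes≗does)

false≢true : false ≢ true
false≢true ()

∨-true⁻ : ∀ {x y} → x ∨ y ≡ true → x ≡ true ⊎ y ≡ true
∨-true⁻ {true}  _ = inj₁ refl
∨-true⁻ {false} e = inj₂ e

∧-true⁻ : ∀ {x y} → x ∧ y ≡ true → x ≡ true × y ≡ true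
∧-true⁻ {x} {y} e = ∧-conicalˡ x y e , ∧-conicalʳ x y e

∧-true⁺ : ∀ {x y} → x ≡ true → y ≡ true → x ∧ y ≡ true
∧-true⁺ refl refl = refl

not-true⁻ : ∀ {x} → not x ≡ true → x ≡ false
not-true⁻ {false} _ = refl

not-true⁺ : ∀ {x} → x ≡ false → not x ≡ true
not-true⁺ refl = refl

true⇔true⇒≡ : ∀ {x y : Bool} → (x ≡ true → y ≡ true) → (y ≡ true → x ≡ true) → x ≡ y
true⇔true⇒≡ {true}  {true}  _ _ = refl
true⇔true⇒≡ {true}  {false} f _ = sym (f refl)
true⇔true⇒≡ {false} {true}  _ g = g refl
true⇔true⇒≡ {false} {false} _ _ = refl

T⇒≡true : ∀ {b} → T b → b ≡ true
T⇒≡true {true} _ = refl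

≡ᵇ-true⁻ : ∀ {m n} → (m ≡ᵇ n) ≡ true → m ≡ n
≡ᵇ-true⁻ {m} {n} e = ≡ᵇ⇒≡ m n (subst T (sym e) _)

≡ᵇ-true⁺ : ∀ {m n} → m ≡ n → (m ≡ᵇ n) ≡ true
≡ᵇ-true⁺ {m} {n} e = T⇒≡true (≡⇒≡ᵇ m n e)

⌊≟⌋-true⁺ : ∀ {n} {a b : Fin n} → a ≡ b → ⌊ a ≟ b ⌋ ≡ true
⌊≟⌋-true⁺ {a = a} {b} e = trans (isYes≗does (a ≟ b)) (dec-true (a ≟ b) e)

⌊≟⌋-false⁺ : ∀ {n} {a b : Fin n} → ¬ a ≡ b → ⌊ a ≟ b ⌋ ≡ false
⌊≟⌋-false⁺ {a = a} {b} ne = trans (isYes≗does (a ≟ b)) (dec-false (a ≟ b) ne)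

⌊≟⌋-true⁻ : ∀ {n} {a b : Fin n} → ⌊ a ≟ b ⌋ ≡ true → a ≡ b
⌊≟⌋-true⁻ {a = a} {b} e with a ≟ b
... | yes p = p

⌊≟⌋-sym : ∀ {n} (a b : Fin n) → ⌊ a ≟ b ⌋ ≡ ⌊ b ≟ a ⌋
⌊≟⌋-sym a b = true⇔true⇒≡ (λ e → ⌊≟⌋-true⁺ (sym (⌊≟⌋-true⁻ e))) (λ e → ⌊≟⌋-true⁺ (sym (⌊≟⌋-true⁻ e)))

⌊≟⌋-suc : ∀ {n} (a b : Fin n) → ⌊ suc a ≟ suc b ⌋ ≡ ⌊ a ≟ b ⌋
⌊≟⌋-suc a b = true⇔true⇒≡ (λ e → ⌊≟⌋-true⁺ (Data.Fin.Properties.suc-injective (⌊≟⌋-true⁻ e)))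
                          (λ e → ⌊≟⌋-true⁺ (cong suc (⌊≟⌋-true⁻ e)))

count : ∀ {n} → (Fin n → Bool) → ℕ
count {zero}  P = 0
count {suc n} P = (if P zero then 1 else 0) + count (P ∘ suc)

module _ {n : ℕ} where

  dropZero : List (Fin (suc n)) → List (Fin n)
  dropZero []           = []
  dropZero (zero  ∷ xs) = dropZero xs
  dropZero (suc x ∷ xs) = x ∷ dropZero xs

  length-dropZero≤ : ∀ xs → length (dropZero xs) ≤ length xs
  length-dropZero≤ []           = z≤n
  length-dropZero≤ (zero  ∷ xs) = m≤n⇒m≤1+n (length-dropZero≤ xs)
  length-dropZero≤ (suc x ∷ xs) = s≤s (length-dropZero≤ xs)

  length-dropZero< : ∀ xs → zero ∈ xs → length (dropZero xs) < length xs
  length-dropZero< (zero  ∷ xs) _         = s≤s (length-dropZero≤ xs)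
  length-dropZero< (suc x ∷ xs) (there p) = s≤s (length-dropZero< xs p)

  ∈-dropZero⁺ : ∀ {y} xs → suc y ∈ xs → y ∈ dropZero xs
  ∈-dropZero⁺ (zero  ∷ xs) (there p)    = ∈-dropZero⁺ xs p
  ∈-dropZero⁺ (suc x ∷ xs) (here refl)  = here refl
  ∈-dropZero⁺ (suc x ∷ xs) (there p)    = there (∈-dropZero⁺ xs p)

  ∈-dropZero⁻ : ∀ {y} xs → y ∈ dropZero xs → suc y ∈ xs
  ∈-dropZero⁻ (zero  ∷ xs) p           = there (∈-dropZero⁻ xs p)
  ∈-dropZero⁻ (suc x ∷ xs) (here refl) = here refl
  ∈-dropZero⁻ (suc x ∷ xs) (there p)   = there (∈-dropZero⁻ xs p)

  dropZero-unique : ∀ xs → Unique xs → Unique (dropZero xs)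
  dropZero-unique []           _       = []
  dropZero-unique (zero  ∷ xs) (_ ∷ u) = dropZero-unique xs u
  dropZero-unique (suc x ∷ xs) (x∉ ∷ u) =
    ¬Any⇒All¬ (dropZero xs) (All¬⇒¬Any x∉ ∘ ∈-dropZero⁻ xs) ∷ dropZero-unique xs u

  unique-length≤dropZero : ∀ xs → Unique xs → zero ∉ xs → length xs ≤ length (dropZero xs)
  unique-length≤dropZero []           _       _  = z≤n
  unique-length≤dropZero (zero  ∷ xs) _       0∉ = ⊥-elim (0∉ (here refl))
  unique-length≤dropZero (suc x ∷ xs) (_ ∷ u) 0∉ = s≤s (unique-length≤dropZero xs u (0∉ ∘ there))

  unique-length≤1+dropZero : ∀ xs → Unique xs → length xs ≤ suc (length (dropZero xs))
  unique-length≤1+dropZero []           _        = z≤n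
  unique-length≤1+dropZero (zero  ∷ xs) (0∉ ∷ u) = s≤s (unique-length≤dropZero xs u (All¬⇒¬Any 0∉))
  unique-length≤1+dropZero (suc x ∷ xs) (_ ∷ u)  = s≤s (unique-length≤1+dropZero xs u)

Unique⇒length≤count : ∀ {n} (P : Fin n → Bool) (xs : List (Fin n)) → Unique xs →
                      (∀ x → x ∈ xs → P x ≡ true) → length xs ≤ count P
Unique⇒length≤count {zero}  P []       _ _  = z≤n
Unique⇒length≤count {suc n} P xs u xs⊆P with P zero in P0
... | true  = ≤-trans (unique-length≤1+dropZero xs u) (s≤s rest)
  where rest = Unique⇒length≤count (P ∘ suc) (dropZero xs) (dropZero-unique xs u) (λ x m → xs⊆P (suc x) (∈-dropZero⁻ xs m))
... | false = ≤-trans (unique-length≤dropZero xs u (λ m → false≢true (trans (sym P0) (xs⊆P zero m)))) rest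
  where rest = Unique⇒length≤count (P ∘ suc) (dropZero xs) (dropZero-unique xs u) (λ x m → xs⊆P (suc x) (∈-dropZero⁻ xs m))

count≤length : ∀ {n} (P : Fin n → Bool) (xs : List (Fin n)) → (∀ y → P y ≡ true → y ∈ xs) → count P ≤ length xs
count≤length {zero}  P xs _    = z≤n
count≤length {suc n} P xs P⊆xs with P zero in P0
... | true  = <-≤-trans (s≤s rest) (length-dropZero< xs (P⊆xs zero P0))
  where rest = count≤length (P ∘ suc) (dropZero xs) (λ y e → ∈-dropZero⁺ xs (P⊆xs (suc y) e))
... | false = ≤-trans rest (length-dropZero≤ xs)
  where rest = count≤length (P ∘ suc) (dropZero xs) (λ y e → ∈-dropZero⁺ xs (P⊆xs (suc y) e))

count≤length⇒∈ : ∀ {n} (P : Fin n → Bool) (xs : List (Fin n)) → Unique xs → (∀ x → x ∈ xs → P x ≡ true) →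
                 count P ≤ length xs → ∀ y → P y ≡ true → y ∈ xs
count≤length⇒∈ P xs u xs⊆P P≤xs y Py with Any.any? (y ≟_) xs
... | yes y∈xs = y∈xs
... | no  y∉xs = ⊥-elim (<⇒≱ (s≤s ≤-refl) (≤-trans longer P≤xs))
  where
  longer : length (y ∷ xs) ≤ count P
  longer = Unique⇒length≤count P (y ∷ xs) (¬Any⇒All¬ xs y∉xs ∷ u)
             (λ { x (here refl) → Py ; x (there m) → xs⊆P x m })

count-cong : ∀ {n} {P Q : Fin n → Bool} → (∀ x → P x ≡ Q x) → count P ≡ count Q
count-cong {zero}  _   = refl
count-cong {suc n} P≗Q = cong₂ _+_ (cong (if_then 1 else 0) (P≗Q zero)) (count-cong (P≗Q ∘ suc))

count-split : ∀ {n} (P Q : Fin n → Bool) → count P ≡ count (λ x → P x ∧ Q x) + count (λ x → P x ∧ not (Q x))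
count-split {zero}  P Q = refl
count-split {suc n} P Q with P zero | Q zero
... | true  | true  = cong suc (count-split (P ∘ suc) (Q ∘ suc))
... | true  | false = trans (cong suc (count-split (P ∘ suc) (Q ∘ suc))) (sym (+-suc _ _))
... | false | _     = count-split (P ∘ suc) (Q ∘ suc)

count-∨ : ∀ {n} (P Q : Fin n → Bool) → count (λ x → P x ∨ Q x) ≤ count P + count Q
count-∨ {zero}  P Q = z≤n
count-∨ {suc n} P Q with P zero | Q zero
... | true  | true  = s≤s (≤-trans (count-∨ (P ∘ suc) (Q ∘ suc)) (+-monoʳ-≤ (count (P ∘ suc)) (n≤1+n _)))
... | true  | false = s≤s (count-∨ (P ∘ suc) (Q ∘ suc))
... | false | true  = ≤-trans (s≤s (count-∨ (P ∘ suc) (Q ∘ suc))) (≤-reflexive (sym (+-suc _ _)))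
... | false | false = count-∨ (P ∘ suc) (Q ∘ suc)

count+count-not : ∀ {n} (P : Fin n → Bool) → count P + count (not ∘ P) ≡ n
count+count-not {zero}  P = refl
count+count-not {suc n} P with P zero
... | true  = cong suc (count+count-not (P ∘ suc))
... | false = trans (+-suc _ _) (cong suc (count+count-not (P ∘ suc)))

sum-indicator≡count : ∀ {n} (P : Fin n → Bool) → sum (map (λ u → if P u then 1 else 0) (allFin n)) ≡ count P
sum-indicator≡count {n} P = trans (cong sum (map-tabulate (λ x → x) (λ u → if P u then 1 else 0))) (go P)
  where
  go : ∀ {m} (Q : Fin m → Bool) → sum (tabulate (λ u → if Q u then 1 else 0)) ≡ count Q
  go {zero}  Q = refl
  go {suc m} Q = cong ((if Q zero then 1 else 0) +_) (go (Q ∘ suc))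

∣S∣≡count : ∀ {n} (S : Subset n) → ∣ S ∣ ≡ count (Vec.lookup S)
∣S∣≡count Vec.[]            = refl
∣S∣≡count (true  Vec.∷ S) = cong suc (∣S∣≡count S)
∣S∣≡count (false Vec.∷ S) = ∣S∣≡count S

∈ₛ⇒lookup≡true : ∀ {n} {S : Subset n} {x} → x ∈ₛ S → Vec.lookup S x ≡ true
∈ₛ⇒lookup≡true = []=⇒lookup

∈ₛ-tabulate⁺ : ∀ {n} (P : Fin n → Bool) {x} → P x ≡ true → x ∈ₛ Vec.tabulate P
∈ₛ-tabulate⁺ P {x} e = lookup⇒[]= x (Vec.tabulate P) (trans (lookup∘tabulate P x) e)

∣tabulate∣≡count : ∀ {n} (P : Fin n → Bool) → ∣ Vec.tabulate P ∣ ≡ count P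
∣tabulate∣≡count P = trans (∣S∣≡count (Vec.tabulate P)) (count-cong (lookup∘tabulate P))

consecutive? : ℕ → ℕ → Bool
consecutive? i j = (suc i ≡ᵇ j) ∨ (suc j ≡ᵇ i)

consecutive?-true⁻ : ∀ {i j} → consecutive? i j ≡ true → suc i ≡ j ⊎ suc j ≡ i
consecutive?-true⁻ {i} {j} e with ∨-true⁻ {suc i ≡ᵇ j} e
... | inj₁ p = inj₁ (≡ᵇ-true⁻ p)
... | inj₂ p = inj₂ (≡ᵇ-true⁻ p)

consecutive?-true⁺ : ∀ {i j} → suc i ≡ j ⊎ suc j ≡ i → consecutive? i j ≡ true
consecutive?-true⁺ (inj₁ p) rewrite ≡ᵇ-true⁺ p = refl
consecutive?-true⁺ (inj₂ p) rewrite ≡ᵇ-true⁺ p = ∨-zeroʳ _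

consecutive?-sym : ∀ i j → consecutive? i j ≡ consecutive? j i
consecutive?-sym i j = ∨-comm (suc i ≡ᵇ j) (suc j ≡ᵇ i)

module Walks (G : Graph) where

  V : Set
  V = Fin (order G)

  infix 4 _~_
  _~_ : V → V → Set
  u ~ v = adj G u v ≡ true

  ~-sym : ∀ {u v} → u ~ v → v ~ u
  ~-sym {u} {v} e = trans (adj-sym G v u) e

  ~-irrefl : ∀ {u v} → u ~ v → ¬ u ≡ v
  ~-irrefl {u} e refl with trans (sym e) (adj-irrefl G u)
  ... | ()

  infixr 5 _++ʷ_
  _++ʷ_ : ∀ {u v w i j} → Walk G u v i → Walk G v w j → Walk G u w (i + j)
  here       ++ʷ w = w
  step e w₁ ++ʷ w = step e (w₁ ++ʷ w)

  reverseʷ : ∀ {u v i} → Walk G u v i → Walk G v u i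
  reverseʷ here = here
  reverseʷ {u} {v} {suc i} (step e w) = subst (Walk G v u) (+-comm i 1) (reverseʷ w ++ʷ step (~-sym e) here)

  Within : V → V → ℕ → Set
  Within u v k = ∃ λ j → j ≤ k × Walk G u v j

  within-refl : ∀ {u k} → Within u u k
  within-refl = 0 , z≤n , here

  within-edge : ∀ {u v k} → 1 ≤ k → u ~ v → Within u v k
  within-edge 1≤k e = 1 , 1≤k , step e here

  within-trans : ∀ {u v w k l} → Within u v k → Within v w l → Within u w (k + l)
  within-trans (j₁ , j₁≤k , w₁) (j₂ , j₂≤l , w₂) = j₁ + j₂ , +-mono-≤ j₁≤k j₂≤l , w₁ ++ʷ w₂

  within-sym : ∀ {u v k} → Within u v k → Within v u k
  within-sym (j , j≤k , w) = j , j≤k , reverseʷ w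

  within-mono : ∀ {u v k l} → k ≤ l → Within u v k → Within u v l
  within-mono k≤l (j , j≤k , w) = j , ≤-trans j≤k k≤l , w

  deg≡count : ∀ v → deg G v ≡ count (adj G v)
  deg≡count v = sum-indicator≡count (adj G v)

  leaf-neighbour-unique : ∀ {v a b} → IsLeaf G v → v ~ a → v ~ b → a ≡ b
  leaf-neighbour-unique {v} {a} {b} leaf va vb with a ≟ b
  ... | yes a≡b = a≡b
  ... | no  a≢b = ⊥-elim (<⇒≱ (s≤s (s≤s z≤n)) (≤-trans two (≤-reflexive (trans (sym (deg≡count v)) leaf))))
    where
    two : 2 ≤ count (adj G v)
    two = Unique⇒length≤count (adj G v) (a ∷ b ∷ []) ((a≢b ∷ []) ∷ [] ∷ [])
            (λ { x (here refl) → va ; x (there (here refl)) → vb })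

  NonLeaf⇒other-neighbour : ∀ {v a} → NonLeaf G v → v ~ a → Σ V λ b → ¬ b ≡ a × v ~ b
  NonLeaf⇒other-neighbour {v} {a} nonLeaf va with any? (λ b → ¬? (b ≟ a) ×-dec (adj G v b ≟ᵇ true))
  ... | yes found = found
  ... | no  none  = ⊥-elim (nonLeaf (trans (deg≡count v) (≤-antisym atMostOne atLeastOne)))
    where
    atMostOne : count (adj G v) ≤ 1
    atMostOne = count≤length (adj G v) (a ∷ []) only-a
      where
      only-a : ∀ y → v ~ y → y ∈ a ∷ []
      only-a y vy with y ≟ a
      ... | yes y≡a = here y≡a
      ... | no  y≢a = ⊥-elim (none (y , y≢a , vy))
    atLeastOne : 1 ≤ count (adj G v)
    atLeastOne = Unique⇒length≤count (adj G v) (a ∷ []) ([] ∷ []) (λ { x (here refl) → va })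

  AdjacentSteps : (ℕ → V) → ℕ → Set
  AdjacentSteps p L = ∀ t → t < L → p t ~ p (suc t)

  InjectiveUpTo : (ℕ → V) → ℕ → Set
  InjectiveUpTo p L = ∀ s t → s ≤ L → t ≤ L → p s ≡ p t → s ≡ t

  stepsWalk : (p : ℕ → V) (L : ℕ) → AdjacentSteps p L → Walk G (p 0) (p L) L
  stepsWalk p zero    _     = here
  stepsWalk p (suc L) steps = step (steps 0 (s≤s z≤n)) (stepsWalk (p ∘ suc) L (λ t t<L → steps (suc t) (s≤s t<L)))

  points : (ℕ → V) → ℕ → List V
  points p zero    = p 0 ∷ []
  points p (suc L) = p 0 ∷ points (p ∘ suc) L

  walkVerts-stepsWalk : ∀ p L (steps : AdjacentSteps p L) → walkVerts G (stepsWalk p L steps) ≡ points p L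
  walkVerts-stepsWalk p zero    _ = refl
  walkVerts-stepsWalk p (suc L) _ = cong (p 0 ∷_) (walkVerts-stepsWalk (p ∘ suc) L _)

  length-points : ∀ p L → length (points p L) ≡ suc L
  length-points p zero    = refl
  length-points p (suc L) = cong suc (length-points (p ∘ suc) L)

  ∈-points⁻ : ∀ p L {x} → x ∈ points p L → Σ ℕ λ t → t ≤ L × p t ≡ x
  ∈-points⁻ p zero    (here refl) = 0 , z≤n , refl
  ∈-points⁻ p (suc L) (here refl) = 0 , z≤n , refl
  ∈-points⁻ p (suc L) (there m) with ∈-points⁻ (p ∘ suc) L m
  ... | t , t≤L , e = suc t , s≤s t≤L , e

  points-unique : ∀ p L → InjectiveUpTo p L → Unique (points p L)
  points-unique p zero    _   = [] ∷ []
  points-unique p (suc L) inj = ¬Any⇒All¬ _ p0∉ ∷ points-unique (p ∘ suc) L inj∘suc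
    where
    inj∘suc : InjectiveUpTo (p ∘ suc) L
    inj∘suc s t s≤L t≤L e = suc-injective (inj (suc s) (suc t) (s≤s s≤L) (s≤s t≤L) e)
    p0∉ : ¬ p 0 ∈ points (p ∘ suc) L
    p0∉ m with ∈-points⁻ (p ∘ suc) L m
    ... | t , t≤L , e with inj 0 (suc t) z≤n (s≤s t≤L) (sym e)
    ... | ()

  closedPath⇒HasCycle : ∀ p L → AdjacentSteps p L → InjectiveUpTo p L → 2 ≤ L → p L ~ p 0 → HasCycle G
  closedPath⇒HasCycle p L steps inj 2≤L closing =
    p 0 , p L , L , stepsWalk p L steps , 2≤L , closing ,
    subst Unique (sym (walkVerts-stepsWalk p L steps)) (points-unique p L inj)

  AdjacentSteps-drop : ∀ p L s c → s + c ≤ L → AdjacentSteps p L → AdjacentSteps (p ∘ (s +_)) c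
  AdjacentSteps-drop p L s c s+c≤L steps t t<c =
    subst (λ z → p (s + t) ~ p z) (sym (+-suc s t))
      (steps (s + t) (≤-trans (subst (_≤ s + c) (+-suc s t) (+-monoʳ-≤ s t<c)) s+c≤L))

  InjectiveUpTo-drop : ∀ p L s c → s + c ≤ L → InjectiveUpTo p L → InjectiveUpTo (p ∘ (s +_)) c
  InjectiveUpTo-drop p L s c s+c≤L inj i j i≤c j≤c e =
    +-cancelˡ-≡ s i j (inj (s + i) (s + j) (≤-trans (+-monoʳ-≤ s i≤c) s+c≤L) (≤-trans (+-monoʳ-≤ s j≤c) s+c≤L) e)

  segment-within : ∀ p L → AdjacentSteps p L → ∀ s t → s ≤ t → t ≤ L → Within (p s) (p t) (t ∸ s)
  segment-within p L steps s t s≤t t≤L =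
    t ∸ s , ≤-refl ,
    subst₂ (λ a b → Walk G a b (t ∸ s)) (cong p (+-identityʳ s)) (cong p (m+[n∸m]≡n s≤t))
      (stepsWalk (p ∘ (s +_)) (t ∸ s)
        (AdjacentSteps-drop p L s (t ∸ s) (subst (_≤ L) (sym (m+[n∸m]≡n s≤t)) t≤L) steps))

  module _ (acyclic : ¬ HasCycle G) where

    chord⇒consecutive : ∀ p L → AdjacentSteps p L → InjectiveUpTo p L →
                        ∀ s t → s < t → t ≤ L → p s ~ p t → suc s ≡ t
    chord⇒consecutive p L steps inj s t s<t t≤L ps~pt with suc s ≟ℕ t
    ... | yes e = e
    ... | no  ne = ⊥-elim (acyclic (closedPath⇒HasCycle (p ∘ (s +_)) c
                    (AdjacentSteps-drop p L s c s+c≤L steps) (InjectiveUpTo-drop p L s c s+c≤L inj) 2≤c closing))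
      where
      c = t ∸ s
      s+c≡t : s + c ≡ t
      s+c≡t = m+[n∸m]≡n (<⇒≤ s<t)
      s+c≤L : s + c ≤ L
      s+c≤L = subst (_≤ L) (sym s+c≡t) t≤L
      2≤c : 2 ≤ c
      2≤c = m+n≤o⇒m≤o∸n 2 (≤∧≢⇒< s<t ne)
      closing : p (s + c) ~ p (s + 0)
      closing = subst₂ _~_ (cong p (sym s+c≡t)) (cong p (sym (+-identityʳ s))) (~-sym ps~pt)

    adj≡consecutive? : ∀ p L → AdjacentSteps p L → InjectiveUpTo p L →
                       ∀ s t → s ≤ L → t ≤ L → adj G (p s) (p t) ≡ consecutive? s t
    adj≡consecutive? p L steps inj s t s≤L t≤L = true⇔true⇒≡ chord⇒steps steps⇒adj
      where
      chord⇒steps : p s ~ p t → consecutive? s t ≡ true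
      chord⇒steps e with <-cmp s t
      ... | tri< s<t _ _  = consecutive?-true⁺ (inj₁ (chord⇒consecutive p L steps inj s t s<t t≤L e))
      ... | tri≈ _ refl _ = ⊥-elim (~-irrefl e refl)
      ... | tri> _ _ t<s  = consecutive?-true⁺ (inj₂ (chord⇒consecutive p L steps inj t s t<s s≤L (~-sym e)))
      steps⇒adj : consecutive? s t ≡ true → p s ~ p t
      steps⇒adj e with consecutive?-true⁻ {s} e
      ... | inj₁ refl = steps s t≤L
      ... | inj₂ refl = ~-sym (steps t s≤L)

HasCycle-map : ∀ {G H : Graph} (g : Fin (order G) → Fin (order H)) → (∀ {a b} → g a ≡ g b → a ≡ b) →
               (∀ a b → adj G a b ≡ true → adj H (g a) (g b) ≡ true) → HasCycle G → HasCycle H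
HasCycle-map {G} {H} g g-inj g-adj (u , v , k , w , 2≤k , closing , uniq) =
  g u , g v , k , mapʷ w , 2≤k , g-adj v u closing , subst Unique (sym (walkVerts-mapʷ w)) (map⁺ g-inj uniq)
  where
  mapʷ : ∀ {u v k} → Walk G u v k → Walk H (g u) (g v) k
  mapʷ here       = here
  mapʷ (step e w) = step (g-adj _ _ e) (mapʷ w)
  walkVerts-mapʷ : ∀ {u v k} (w : Walk G u v k) → walkVerts H (mapʷ w) ≡ map g (walkVerts G w)
  walkVerts-mapʷ here       = refl
  walkVerts-mapʷ (step e w) = cong (g _ ∷_) (walkVerts-mapʷ w)

leastWitness : (P : ℕ → Set) → (∀ k → Dec (P k)) → ∀ K → P K → Σ ℕ λ m → P m × (∀ j → P j → m ≤ j)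
leastWitness P P? zero    p0 = 0 , p0 , (λ _ _ → z≤n)
leastWitness P P? (suc K) pK with P? 0
... | yes p0  = 0 , p0 , (λ _ _ → z≤n)
... | no  ¬p0 with leastWitness (P ∘ suc) (P? ∘ suc) K pK
...   | m , pm , least = suc m , pm , least′
  where
  least′ : ∀ j → P j → suc m ≤ j
  least′ zero    pj = ⊥-elim (¬p0 pj)
  least′ (suc j) pj = s≤s (least j pj)

module Rooted (T : Graph) (tree : IsTree T) (r : Fin (order T)) where
  open Walks T

  acyclic : ¬ HasCycle T
  acyclic = proj₂ tree

  walk? : ∀ u v k → Dec (Walk T u v k)
  walk? u v zero with u ≟ v
  ... | yes refl = yes here
  ... | no  u≢v  = no (λ { here → u≢v refl })
  walk? u v (suc k) with any? (λ w → (adj T u w ≟ᵇ true) ×-dec walk? w v k)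
  ... | yes (w , e , p) = yes (step e p)
  ... | no  none        = no (λ { (step e p) → none (_ , e , p) })

  opaque
    shortestWalk : ∀ y → Σ ℕ λ m → Walk T y r m × (∀ j → Walk T y r j → m ≤ j)
    shortestWalk y = leastWitness (λ k → Walk T y r k) (walk? y r) _ (proj₂ (proj₁ tree y r))

    depth : V → ℕ
    depth y = proj₁ (shortestWalk y)

    depthWalk : ∀ y → Walk T y r (depth y)
    depthWalk y = proj₁ (proj₂ (shortestWalk y))

    depth-minimal : ∀ y j → Walk T y r j → depth y ≤ j
    depth-minimal y = proj₂ (proj₂ (shortestWalk y))

    second : ∀ {y k} → Walk T y r k → V
    second here                 = r
    second (step {w = w} _ _) = w

    parent : V → V
    parent y = second (depthWalk y)

    depth-root : depth r ≡ 0
    depth-root = n≤0⇒n≡0 (depth-minimal r 0 here)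

    depth≡0⇒root : ∀ {y} → depth y ≡ 0 → y ≡ r
    depth≡0⇒root {y} = go (depthWalk y)
      where
      go : ∀ {y k} → Walk T y r k → k ≡ 0 → y ≡ r
      go here _ = refl

    parent-root : parent r ≡ r
    parent-root = go (depthWalk r) depth-root
      where
      go : ∀ {k} (w : Walk T r r k) → k ≡ 0 → second w ≡ r
      go here _ = refl

    parent-spec : ∀ {y k} (w : Walk T y r k) → (∀ j → Walk T y r j → k ≤ j) → ¬ y ≡ r →
                  y ~ second w × k ≡ suc (depth (second w))
    parent-spec here _ y≢r = ⊥-elim (y≢r refl)
    parent-spec (step {w = p} {k = k} e w) shortest _ =
      e , cong suc (≤-antisym (≤-pred (shortest (suc (depth p)) (step e (depthWalk p)))) (depth-minimal p k w))

    parent~ : ∀ {y} → ¬ y ≡ r → y ~ parent y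
    parent~ {y} y≢r = proj₁ (parent-spec (depthWalk y) (depth-minimal y) y≢r)

    depth-parent : ∀ {y} → ¬ y ≡ r → depth y ≡ suc (depth (parent y))
    depth-parent {y} y≢r = proj₂ (parent-spec (depthWalk y) (depth-minimal y) y≢r)

  depth>0⇒≢root : ∀ {y} → 0 < depth y → ¬ y ≡ r
  depth>0⇒≢root {y} 0<d refl = <⇒≢ 0<d (sym depth-root)

  depth-parent≡pred : ∀ y → depth (parent y) ≡ pred (depth y)
  depth-parent≡pred y with y ≟ r
  ... | yes y≡r  = subst (λ v → depth (parent v) ≡ pred (depth v)) (sym y≡r)
                     (trans (cong depth parent-root) (trans depth-root (cong pred (sym depth-root))))
  ... | no  y≢r  = cong pred (sym (depth-parent y≢r))

  ancestor : ℕ → V → V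
  ancestor zero    y = y
  ancestor (suc t) y = parent (ancestor t y)

  depth-ancestor : ∀ t y → depth (ancestor t y) ≡ depth y ∸ t
  depth-ancestor zero    y = refl
  depth-ancestor (suc t) y = begin
    depth (parent (ancestor t y)) ≡⟨ depth-parent≡pred (ancestor t y) ⟩
    pred (depth (ancestor t y))   ≡⟨ cong pred (depth-ancestor t y) ⟩
    pred (depth y ∸ t)            ≡⟨ pred[m∸n]≡m∸[1+n] (depth y) t ⟩
    depth y ∸ suc t               ∎
    where open ≡-Reasoning

  ancestor-+ : ∀ s t y → ancestor (s + t) y ≡ ancestor s (ancestor t y)
  ancestor-+ zero    t y = refl
  ancestor-+ (suc s) t y = cong parent (ancestor-+ s t y)

  ancestor-depth≡root : ∀ y → ancestor (depth y) y ≡ r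
  ancestor-depth≡root y = depth≡0⇒root (trans (depth-ancestor (depth y) y) (n∸n≡0 (depth y)))

  ancestor-steps : ∀ y → AdjacentSteps (λ t → ancestor t y) (depth y)
  ancestor-steps y t t<d = parent~ (depth>0⇒≢root (subst (0 <_) (sym (depth-ancestor t y)) (m<n⇒0<n∸m t<d)))

  ancestor-injective : ∀ y → InjectiveUpTo (λ t → ancestor t y) (depth y)
  ancestor-injective y s t s≤d t≤d e =
    ∸-cancelˡ-≡ s≤d t≤d (trans (sym (depth-ancestor s y)) (trans (cong depth e) (depth-ancestor t y)))

  within-root : ∀ y → Within r y (depth y)
  within-root y = within-sym (subst (λ v → Within y v (depth y)) (ancestor-depth≡root y)
                    (segment-within (λ t → ancestor t y) (depth y) (ancestor-steps y) 0 (depth y) z≤n ≤-refl))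

  _≼?_ : V → V → Bool
  x ≼? z = (depth x ≤ᵇ depth z) ∧ ⌊ ancestor (depth z ∸ depth x) z ≟ x ⌋

  ≼?-ancestor : ∀ z t → t ≤ depth z → ancestor t z ≼? z ≡ true
  ≼?-ancestor z t t≤d rewrite depth-ancestor t z | m∸[m∸n]≡n t≤d | T⇒≡true (≤⇒≤ᵇ (m∸n≤m (depth z) t))
    = ⌊≟⌋-true⁺ refl

  ≼?-true⁻ : ∀ x z → x ≼? z ≡ true → Σ ℕ λ t → t ≤ depth z × ancestor t z ≡ x
  ≼?-true⁻ x z e = depth z ∸ depth x , m∸n≤m (depth z) (depth x) , ⌊≟⌋-true⁻ (∧-conicalʳ _ _ e)

  module TreePath (y z : V) where

    root≼z-from-y : ancestor (depth y) y ≼? z ≡ true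
    root≼z-from-y = subst (λ v → v ≼? z ≡ true) (sym (ancestor-depth≡root y))
                      (subst (λ v → v ≼? z ≡ true) (ancestor-depth≡root z) (≼?-ancestor z (depth z) ≤-refl))

    opaque
      lowestCommon : Σ ℕ λ m → ancestor m y ≼? z ≡ true × (∀ j → ancestor j y ≼? z ≡ true → m ≤ j)
      lowestCommon = leastWitness (λ m → ancestor m y ≼? z ≡ true) (λ m → ancestor m y ≼? z ≟ᵇ true)
                       (depth y) root≼z-from-y

    up : ℕ
    up = proj₁ lowestCommon

    up-minimal : ∀ m → ancestor m y ≼? z ≡ true → up ≤ m
    up-minimal = proj₂ (proj₂ lowestCommon)

    up≤depth : up ≤ depth y
    up≤depth = up-minimal (depth y) root≼z-from-y

    private
      meeting : Σ ℕ λ t → t ≤ depth z × ancestor t z ≡ ancestor up y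
      meeting = ≼?-true⁻ (ancestor up y) z (proj₁ (proj₂ lowestCommon))

    down : ℕ
    down = proj₁ meeting

    down≤depth : down ≤ depth z
    down≤depth = proj₁ (proj₂ meeting)

    meet : ancestor down z ≡ ancestor up y
    meet = proj₂ (proj₂ meeting)

    len : ℕ
    len = up + down

    vertex : ℕ → V
    vertex t with t ≤? up
    ... | yes _ = ancestor t y
    ... | no  _ = ancestor (len ∸ t) z

    vertex-up : ∀ t → t ≤ up → vertex t ≡ ancestor t y
    vertex-up t t≤up with t ≤? up
    ... | yes _    = refl
    ... | no  t≰up = ⊥-elim (t≰up t≤up)

    vertex-down : ∀ t → ¬ t ≤ up → vertex t ≡ ancestor (len ∸ t) z
    vertex-down t t≰up with t ≤? up
    ... | yes t≤up = ⊥-elim (t≰up t≤up)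
    ... | no  _    = refl

    vertex-0 : vertex 0 ≡ y
    vertex-0 = vertex-up 0 z≤n

    vertex-len : vertex len ≡ z
    vertex-len = by (len ≤? up)
      where
      open ≡-Reasoning
      by : Dec (len ≤ up) → vertex len ≡ z
      by (no  len≰up) = trans (vertex-down len len≰up) (cong (λ q → ancestor q z) (n∸n≡0 len))
      by (yes len≤up) = begin
        vertex len          ≡⟨ vertex-up len len≤up ⟩
        ancestor len y      ≡⟨ cong (λ q → ancestor q y) len≡up ⟩
        ancestor up y       ≡⟨ sym meet ⟩
        ancestor down z     ≡⟨ cong (λ q → ancestor q z) down≡0 ⟩
        z                   ∎
        where
        down≡0 : down ≡ 0
        down≡0 = n≤0⇒n≡0 (+-cancelˡ-≤ up down 0 (subst (len ≤_) (sym (+-identityʳ up)) len≤up))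
        len≡up : len ≡ up
        len≡up = trans (cong (up +_) down≡0) (+-identityʳ up)

    private
      down-index≤depth : ∀ t → ¬ t ≤ up → len ∸ t ≤ depth z
      down-index≤depth t t≰up =
        ≤-trans (≤-trans (∸-monoʳ-≤ len (<⇒≤ (≰⇒> t≰up))) (≤-reflexive (m+n∸m≡n up down))) down≤depth

    vertex-steps : AdjacentSteps vertex len
    vertex-steps t t<len with <-cmp t up
    ... | tri< t<up _ _ = subst₂ _~_ (sym (vertex-up t (<⇒≤ t<up))) (sym (vertex-up (suc t) t<up))
                            (ancestor-steps y t (<-≤-trans t<up up≤depth))
    ... | tri≈ _ refl _ = subst₂ _~_ (sym (vertex-up t ≤-refl)) (sym (vertex-down (suc t) 1+n≰n))
                            (~-sym (subst (ancestor (len ∸ suc t) z ~_) (trans (cong (λ q → ancestor q z) turn) meet)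
                              (ancestor-steps z (len ∸ suc t) (subst (_≤ depth z) (sym turn) down≤depth))))
      where
      turn : suc (len ∸ suc t) ≡ down
      turn = trans (sym (+-∸-assoc 1 t<len)) (m+n∸m≡n up down)
    ... | tri> _ _ up<t = subst₂ _~_ (sym (vertex-down t (<⇒≱ up<t))) (sym (vertex-down (suc t) (<⇒≱ (m≤n⇒m≤1+n up<t))))
                            (~-sym (subst (ancestor (len ∸ suc t) z ~_) (cong (λ q → ancestor q z) next)
                              (ancestor-steps z (len ∸ suc t) (subst (_≤ depth z) (sym next) (down-index≤depth t (<⇒≱ up<t))))))
      where
      next : suc (len ∸ suc t) ≡ len ∸ t
      next = sym (+-∸-assoc 1 t<len)

    private
      up-side≢down-side : ∀ s t → s ≤ up → ¬ t ≤ up → t ≤ len → ancestor s y ≢ ancestor (len ∸ t) z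
      up-side≢down-side s t s≤up t≰up t≤len e′ = <⇒≢ m<down (sym down≡m)
        where
        m = len ∸ t
        m<down : m < down
        m<down = subst (m <_) (m+n∸m≡n up down) (∸-monoʳ-< (≰⇒> t≰up) t≤len)
        s≡up : s ≡ up
        s≡up = ≤-antisym s≤up (up-minimal s (subst (λ v → v ≼? z ≡ true) (sym e′)
                                 (≼?-ancestor z m (≤-trans (<⇒≤ m<down) down≤depth))))
        down≡m : down ≡ m
        down≡m = ancestor-injective z down m down≤depth (≤-trans (<⇒≤ m<down) down≤depth)
                   (trans meet (trans (cong (λ q → ancestor q y) (sym s≡up)) e′))

    vertex-injective : InjectiveUpTo vertex len
    vertex-injective s t s≤len t≤len e = by (s ≤? up) (t ≤? up)
      where
      by : Dec (s ≤ up) → Dec (t ≤ up) → s ≡ t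
      by (yes s≤up) (yes t≤up) = ancestor-injective y s t (≤-trans s≤up up≤depth) (≤-trans t≤up up≤depth)
                                   (trans (sym (vertex-up s s≤up)) (trans e (vertex-up t t≤up)))
      by (no s≰up)  (no t≰up)  = ∸-cancelˡ-≡ s≤len t≤len
                                   (ancestor-injective z (len ∸ s) (len ∸ t) (down-index≤depth s s≰up) (down-index≤depth t t≰up)
                                     (trans (sym (vertex-down s s≰up)) (trans e (vertex-down t t≰up))))
      by (yes s≤up) (no t≰up)  = ⊥-elim (up-side≢down-side s t s≤up t≰up t≤len
                                   (trans (sym (vertex-up s s≤up)) (trans e (vertex-down t t≰up))))
      by (no s≰up)  (yes t≤up) = ⊥-elim (up-side≢down-side t s t≤up s≰up s≤len
                                   (trans (sym (vertex-up t t≤up)) (trans (sym e) (vertex-down s s≰up))))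

    within : Within y z len
    within = subst₂ (λ u v → Within u v len) vertex-0 vertex-len (segment-within vertex len vertex-steps 0 len z≤n ≤-refl)

  AncestorClosed : (V → Bool) → Set
  AncestorClosed P = P r ≡ true × (∀ y → P y ≡ true → P (parent y) ≡ true)

  AncestorClosed-ancestor : ∀ {P} → AncestorClosed P → ∀ t {y} → P y ≡ true → P (ancestor t y) ≡ true
  AncestorClosed-ancestor closed zero    Py = Py
  AncestorClosed-ancestor closed (suc t) Py = proj₂ closed _ (AncestorClosed-ancestor closed t Py)

  AncestorClosed-vertex : ∀ {P} → AncestorClosed P → ∀ {y z} → P y ≡ true → P z ≡ true → ∀ t → P (TreePath.vertex y z t) ≡ true
  AncestorClosed-vertex closed {y} {z} Py Pz t with t ≤? TreePath.up y z
  ... | yes _ = AncestorClosed-ancestor closed t Py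
  ... | no  _ = AncestorClosed-ancestor closed (TreePath.len y z ∸ t) Pz

  AncestorClosed-len<count : ∀ {P} → AncestorClosed P → ∀ {y z} → P y ≡ true → P z ≡ true → TreePath.len y z < count P
  AncestorClosed-len<count {P} closed {y} {z} Py Pz =
    subst (_≤ count P) (length-points vertex len)
      (Unique⇒length≤count P (points vertex len) (points-unique vertex len vertex-injective) onPath)
    where
    open TreePath y z using (vertex; len; vertex-injective)
    onPath : ∀ x → x ∈ points vertex len → P x ≡ true
    onPath x m with ∈-points⁻ vertex len m
    ... | t , _ , refl = AncestorClosed-vertex closed Py Pz t

  edge⇒parent : ∀ {y z} → y ~ z → parent y ≡ z ⊎ parent z ≡ y
  edge⇒parent {y} {z} y~z = go up down meet len≤1
    where
    open TreePath y z using (up; down; meet; len; vertex; vertex-steps; vertex-injective; vertex-0; vertex-len)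
    len≤1 : len ≤ 1
    len≤1 with 2 ≤? len
    ... | no  2≰len = ≤-pred (≰⇒> 2≰len)
    ... | yes 2≤len = ⊥-elim (acyclic (closedPath⇒HasCycle vertex len vertex-steps vertex-injective 2≤len
                        (subst₂ _~_ (sym vertex-len) (sym vertex-0) (~-sym y~z))))
    go : ∀ i j → ancestor j z ≡ ancestor i y → i + j ≤ 1 → parent y ≡ z ⊎ parent z ≡ y
    go zero          zero          e _ = ⊥-elim (~-irrefl y~z (sym e))
    go (suc zero)    zero          e _ = inj₁ (sym e)
    go zero          (suc zero)    e _ = inj₂ e
    go (suc zero)    (suc j)       _ (s≤s ())
    go (suc (suc i)) _             _ (s≤s ())
    go zero          (suc (suc j)) _ (s≤s ())

length-allFin : ∀ n → length (allFin n) ≡ n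
length-allFin n = length-tabulate {n = n} (λ i → i)

module Corona (S : Graph) (k : ℕ) where

  Vertex : Set
  Vertex = Fin (order S) × Fin (suc k)

  coronaAdj-sym : ∀ p q → coronaAdj S k p q ≡ coronaAdj S k q p
  coronaAdj-sym (a , zero)  (b , zero)  = adj-sym S a b
  coronaAdj-sym (a , zero)  (b , suc j) = cong₂ _∧_ (⌊≟⌋-sym a b) (consecutive?-sym 0 (toℕ (suc j)))
  coronaAdj-sym (a , suc i) (b , zero)  = cong₂ _∧_ (⌊≟⌋-sym a b) (consecutive?-sym (toℕ (suc i)) 0)
  coronaAdj-sym (a , suc i) (b , suc j) = cong₂ _∧_ (⌊≟⌋-sym a b) (consecutive?-sym (toℕ (suc i)) (toℕ (suc j)))

  coronaAdj-same : ∀ a i j → coronaAdj S k (a , i) (a , j) ≡ consecutive? (toℕ i) (toℕ j)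
  coronaAdj-same a zero    zero    = adj-irrefl S a
  coronaAdj-same a zero    (suc j) rewrite ⌊≟⌋-true⁺ (refl {x = a}) = refl
  coronaAdj-same a (suc i) zero    rewrite ⌊≟⌋-true⁺ (refl {x = a}) = refl
  coronaAdj-same a (suc i) (suc j) rewrite ⌊≟⌋-true⁺ (refl {x = a}) = refl

  coronaAdj-different : ∀ a b i j → ¬ a ≡ b → coronaAdj S k (a , i) (b , j) ≡ true → i ≡ zero × j ≡ zero
  coronaAdj-different a b zero    zero    _   _ = refl , refl
  coronaAdj-different a b zero    (suc j) a≢b e rewrite ⌊≟⌋-false⁺ a≢b with e
  ... | ()
  coronaAdj-different a b (suc i) zero    a≢b e rewrite ⌊≟⌋-false⁺ a≢b with e
  ... | ()
  coronaAdj-different a b (suc i) (suc j) a≢b e rewrite ⌊≟⌋-false⁺ a≢b with e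
  ... | ()

  enumeration : List Vertex
  enumeration = cartesianProduct (allFin (order S)) (allFin (suc k))

  enumeration-unique : Unique enumeration
  enumeration-unique = cartesianProduct⁺ (allFin⁺ (order S)) (allFin⁺ (suc k))

  ∈-enumeration : ∀ p → p ∈ enumeration
  ∈-enumeration (a , i) = ∈-cartesianProduct⁺ (∈-allFin a) (∈-allFin i)

  length-enumeration : length enumeration ≡ order S * suc k
  length-enumeration = trans (go (allFin (order S))) (cong (_* suc k) (length-allFin (order S)))
    where
    go : ∀ xs → length (cartesianProduct xs (allFin (suc k))) ≡ length xs * suc k
    go []       = refl
    go (x ∷ xs) = trans (length-++ (map (x ,_) (allFin (suc k))))
                    (cong₂ _+_ (trans (length-map _ (allFin (suc k))) (length-allFin (suc k))) (go xs))

clamp : ∀ k → ℕ → Fin (suc k)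
clamp zero    _       = zero
clamp (suc k) zero    = zero
clamp (suc k) (suc t) = suc (clamp k t)

toℕ-clamp : ∀ k t → t ≤ k → toℕ (clamp k t) ≡ t
toℕ-clamp zero    zero    _         = refl
toℕ-clamp (suc k) zero    _         = refl
toℕ-clamp (suc k) (suc t) (s≤s t≤k) = cong suc (toℕ-clamp k t t≤k)

clamp-toℕ : ∀ k (i : Fin (suc k)) → clamp k (toℕ i) ≡ i
clamp-toℕ zero    zero    = refl
clamp-toℕ (suc k) zero    = refl
clamp-toℕ (suc k) (suc i) = cong suc (clamp-toℕ k i)

InducedIso⇒count≡length : ∀ {X : Set} {adjX : X → X → Bool} {G : Graph} (P : Fin (order G) → Bool) (xs : List X) →
                          Unique xs → (∀ a → a ∈ xs) → InducedIso adjX G (λ v → P v ≡ true) → count P ≡ length xs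
InducedIso⇒count≡length P xs unique complete (f , f-inj , f-in , f-onto , _) =
  trans (≤-antisym (count≤length P (map f xs) P⊆image) (Unique⇒length≤count P (map f xs) (map⁺ (f-inj _ _) unique) image⊆P))
        (length-map f xs)
  where
  P⊆image : ∀ y → P y ≡ true → y ∈ map f xs
  P⊆image y Py with f-onto y Py
  ... | a , refl = ∈-map⁺ f (complete a)
  image⊆P : ∀ x → x ∈ map f xs → P x ≡ true
  image⊆P x m with ∈-map⁻ f m
  ... | a , _ , refl = f-in a

InducedIso-cong : ∀ {X : Set} {adjX : X → X → Bool} {G : Graph} {P Q : Fin (order G) → Set} →
                  (∀ v → P v → Q v) → (∀ v → Q v → P v) → InducedIso adjX G P → InducedIso adjX G Q
InducedIso-cong P⇒Q Q⇒P (f , f-inj , f-in , f-onto , f-adj) =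
  f , f-inj , (λ a → P⇒Q _ (f-in a)) , (λ v Qv → f-onto v (Q⇒P v Qv)) , f-adj

corona-core-acyclic : ∀ {G S k P} → ¬ HasCycle G → InducedIso (coronaAdj S k) G P → ¬ HasCycle S
corona-core-acyclic acyclic (f , f-inj , _ , _ , f-adj) cycle =
  acyclic (HasCycle-map (λ a → f (a , zero)) (λ {a} {b} e → cong proj₁ (f-inj (a , zero) (b , zero) e))
            (λ a b e → trans (sym (f-adj (a , zero) (b , zero))) e) cycle)

InducesTree : (G : Graph) → (Fin (order G) → Set) → ℕ → Set
InducesTree G P n = Σ Graph λ H → (order H ≡ n) × IsTree H × InducedIso (adj H) G P

Unique-lookup-injective : ∀ {X : Set} {xs : List X} → Unique xs → ∀ i j → lookup xs i ≡ lookup xs j → i ≡ j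
Unique-lookup-injective {xs = x ∷ xs} (_ ∷ _)  zero    zero    _ = refl
Unique-lookup-injective {xs = x ∷ xs} (x∉ ∷ _) zero    (suc j) e = ⊥-elim (All¬⇒¬Any x∉ (subst (_∈ xs) (sym e) (∈-lookup j)))
Unique-lookup-injective {xs = x ∷ xs} (x∉ ∷ _) (suc i) zero    e = ⊥-elim (All¬⇒¬Any x∉ (subst (_∈ xs) e (∈-lookup i)))
Unique-lookup-injective {xs = x ∷ xs} (_ ∷ u)  (suc i) (suc j) e = cong suc (Unique-lookup-injective u i j e)

module InducedSubgraph (G : Graph) (P : Fin (order G) → Bool) where
  open Walks G

  private
    P? : ∀ v → Dec (P v ≡ true)
    P? v = P v ≟ᵇ true

  members : List V
  members = filter P? (allFin (order G))

  members-unique : Unique members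
  members-unique = filter⁺ P? (allFin⁺ (order G))

  ∈-members : ∀ v → P v ≡ true → v ∈ members
  ∈-members v Pv = ∈-filter⁺ P? (∈-allFin v) Pv

  length-members : length members ≡ count P
  length-members = ≤-antisym (Unique⇒length≤count P members members-unique (λ x m → proj₂ (∈-filter⁻ P? {xs = allFin (order G)} m)))
                             (count≤length P members ∈-members)

  embed : Fin (length members) → V
  embed = lookup members

  embed-injective : ∀ {a b} → embed a ≡ embed b → a ≡ b
  embed-injective {a} {b} = Unique-lookup-injective members-unique a b

  P-embed : ∀ a → P (embed a) ≡ true
  P-embed a = proj₂ (∈-filter⁻ P? {xs = allFin (order G)} (∈-lookup {xs = members} a))

  preimage : ∀ v → P v ≡ true → Fin (length members)
  preimage v Pv = index (∈-members v Pv)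

  embed-preimage : ∀ v Pv → embed (preimage v Pv) ≡ v
  embed-preimage v Pv = sym (lookup-index (∈-members v Pv))

  graph : Graph
  graph = record { order = length members ; adj = λ a b → adj G (embed a) (embed b)
                 ; adj-sym = λ a b → adj-sym G (embed a) (embed b) ; adj-irrefl = λ a → adj-irrefl G (embed a) }

  liftSteps : ∀ p c → AdjacentSteps p c → (Pp : ∀ t → P (p t) ≡ true) → Walk graph (preimage (p 0) (Pp 0)) (preimage (p c) (Pp c)) c
  liftSteps p zero    _     _  = here
  liftSteps p (suc c) steps Pp = step first (liftSteps (p ∘ suc) c (λ t t<c → steps (suc t) (s≤s t<c)) (Pp ∘ suc))
    where
    first : embed (preimage (p 0) (Pp 0)) ~ embed (preimage (p 1) (Pp 1))
    first = subst₂ _~_ (sym (embed-preimage _ _)) (sym (embed-preimage _ _)) (steps 0 (s≤s z≤n))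

  ConnectedInside : Set
  ConnectedInside = ∀ a b → P a ≡ true → P b ≡ true →
                    Σ (ℕ → V) λ p → Σ ℕ λ c → AdjacentSteps p c × p 0 ≡ a × p c ≡ b × (∀ t → P (p t) ≡ true)

  inducesTree : ¬ HasCycle G → ConnectedInside → InducesTree G (λ v → P v ≡ true) (count P)
  inducesTree acyclic connectedInside =
    graph , length-members , (connected , acyclic ∘ HasCycle-map embed embed-injective (λ _ _ e → e)) ,
    embed , (λ _ _ → embed-injective) , P-embed , (λ v Pv → preimage v Pv , embed-preimage v Pv) , (λ _ _ → refl)
    where
    connected : Connected graph
    connected a b with connectedInside (embed a) (embed b) (P-embed a) (P-embed b)
    ... | p , c , steps , p0 , pc , Pp =
      c , subst₂ (λ u v → Walk graph u v c) (embed-injective (trans (embed-preimage _ _) p0))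
                                            (embed-injective (trans (embed-preimage _ _) pc)) (liftSteps p c steps Pp)

module AddLeaf (S : Graph) (c : Fin (order S)) where

  leafAdj : Fin (suc (order S)) → Fin (suc (order S)) → Bool
  leafAdj zero    zero    = false
  leafAdj zero    (suc b) = ⌊ b ≟ c ⌋
  leafAdj (suc a) zero    = ⌊ a ≟ c ⌋
  leafAdj (suc a) (suc b) = adj S a b

  graph : Graph
  graph = record { order = suc (order S) ; adj = leafAdj ; adj-sym = sym′ ; adj-irrefl = irrefl }
    where
    sym′ : ∀ a b → leafAdj a b ≡ leafAdj b a
    sym′ zero    zero    = refl
    sym′ zero    (suc b) = refl
    sym′ (suc a) zero    = refl
    sym′ (suc a) (suc b) = adj-sym S a b
    irrefl : ∀ a → leafAdj a a ≡ false
    irrefl zero    = refl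
    irrefl (suc a) = adj-irrefl S a

  open Walks graph using (_++ʷ_; reverseʷ)

  connected : Connected S → Connected graph
  connected connS x y = _ , (proj₂ (toLeaf x) ++ʷ reverseʷ (proj₂ (toLeaf y)))
    where
    lift : ∀ {a b k} → Walk S a b k → Walk graph (suc a) (suc b) k
    lift here       = here
    lift (step e w) = step e (lift w)
    toLeaf : ∀ x → ∃ λ k → Walk graph x zero k
    toLeaf zero    = 0 , here
    toLeaf (suc a) = _ , (lift (proj₂ (connS a c)) ++ʷ step (⌊≟⌋-true⁺ refl) here)

K₂ : Graph
K₂ = record { order = 2 ; adj = K2adj ; adj-sym = sym′ ; adj-irrefl = irrefl }
  where
  sym′ : ∀ a b → K2adj a b ≡ K2adj b a
  sym′ zero       zero       = refl
  sym′ zero       (suc zero) = refl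
  sym′ (suc zero) zero       = refl
  sym′ (suc zero) (suc zero) = refl
  irrefl : ∀ a → K2adj a a ≡ false
  irrefl zero       = refl
  irrefl (suc zero) = refl

K₂-tree : IsTree K₂
K₂-tree = connected , acyclic
  where
  connected : Connected K₂
  connected zero       zero       = 0 , here
  connected zero       (suc zero) = 1 , step refl here
  connected (suc zero) zero       = 1 , step refl here
  connected (suc zero) (suc zero) = 0 , here
  acyclic : ¬ HasCycle K₂
  acyclic (u , v , k , w , 2≤k , _ , uniq) = <⇒≱ (subst (3 ≤_) (sym (length-walkVerts w)) (s≤s 2≤k)) (Unique-Fin2-length≤2 uniq)
    where
    length-walkVerts : ∀ {u v k} (w : Walk K₂ u v k) → length (walkVerts K₂ w) ≡ suc k
    length-walkVerts here       = refl
    length-walkVerts (step _ w) = cong suc (length-walkVerts w)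
    Unique-Fin2-length≤2 : ∀ {xs : List (Fin 2)} → Unique xs → length xs ≤ 2
    Unique-Fin2-length≤2 {xs} u = ≤-trans (Unique⇒length≤count (λ _ → true) xs u (λ _ _ → refl)) ≤-refl

InducesTree-2⇒K₂ : ∀ {G P} → InducesTree G P 2 → InducedIso K2adj G P
InducesTree-2⇒K₂ {G} {P} (H , refl , (connected , _) , f , f-inj , f-in , f-onto , f-adj) =
  f , f-inj , f-in , f-onto , λ a b → trans (K2adj≡adj a b) (f-adj a b)
  where
  open Walks H using (_~_; ~-irrefl)
  neighbour-of : ∀ {a b k} → ¬ a ≡ b → Walk H a b k → a ~ b
  neighbour-of {zero}     {zero}     a≢b _ = ⊥-elim (a≢b refl)
  neighbour-of {suc zero} {suc zero} a≢b _ = ⊥-elim (a≢b refl)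
  neighbour-of {zero}     {suc zero} _ (step {w = zero}     e _) = ⊥-elim (~-irrefl e refl)
  neighbour-of {zero}     {suc zero} _ (step {w = suc zero} e _) = e
  neighbour-of {suc zero} {zero}     _ (step {w = zero}     e _) = e
  neighbour-of {suc zero} {zero}     _ (step {w = suc zero} e _) = ⊥-elim (~-irrefl e refl)
  K2adj≡adj : ∀ a b → K2adj a b ≡ adj H a b
  K2adj≡adj zero       zero       = sym (adj-irrefl H zero)
  K2adj≡adj zero       (suc zero) = sym (neighbour-of (λ ()) (proj₂ (connected zero (suc zero))))
  K2adj≡adj (suc zero) zero       = sym (neighbour-of (λ ()) (proj₂ (connected (suc zero) zero)))
  K2adj≡adj (suc zero) (suc zero) = sym (adj-irrefl H (suc zero))

singleton : ∀ {n} → Fin n → Fin n → Bool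
singleton u v = ⌊ v ≟ u ⌋

count-singleton : ∀ {n} (u : Fin n) → count (singleton u) ≡ 1
count-singleton u = ≤-antisym (count≤length (singleton u) (u ∷ []) (λ y e → here (⌊≟⌋-true⁻ e)))
                              (Unique⇒length≤count (singleton u) (u ∷ []) ([] ∷ []) (λ { x (here refl) → ⌊≟⌋-true⁺ refl }))

InducesTree⇒count≡ : ∀ G {P n} → InducesTree G (λ v → P v ≡ true) n → count P ≡ n
InducesTree⇒count≡ G {P} (H , refl , _ , iso) =
  trans (InducedIso⇒count≡length {G = G} P (allFin (order H)) (allFin⁺ _) ∈-allFin iso) (length-allFin (order H))

InTk⇒count≡ : ∀ G {k P} → InTk k G (λ v → P v ≡ true) → Σ Graph λ S → count P ≡ order S * suc k
InTk⇒count≡ G {k} {P} (S , _ , _ , iso) =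
  S , trans (InducedIso⇒count≡length {G = G} P (Corona.enumeration S k) (Corona.enumeration-unique S k) (Corona.∈-enumeration S k) iso)
            (Corona.length-enumeration S k)

+-squeeze : ∀ {a b c d} → a ≤ c → b ≤ d → c + d ≤ a + b → a ≡ c × b ≡ d
+-squeeze a≤c b≤d c+d≤a+b with m≤n⇒m<n∨m≡n a≤c | m≤n⇒m<n∨m≡n b≤d
... | inj₂ a≡c | inj₂ b≡d = a≡c , b≡d
... | inj₁ a<c | _        = ⊥-elim (<⇒≱ (+-mono-<-≤ a<c b≤d) c+d≤a+b)
... | inj₂ _   | inj₁ b<d = ⊥-elim (<⇒≱ (+-mono-≤-< a≤c b<d) c+d≤a+b)

connected⇒neighbour : ∀ {G} → Connected G → 2 ≤ order G → ∀ c → Σ (Fin (order G)) λ b → adj G c b ≡ true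
connected⇒neighbour {G} connected 2≤n c with other 2≤n c
  where
  other : ∀ {m} → 2 ≤ m → (c : Fin m) → Σ (Fin m) λ o → ¬ c ≡ o
  other {suc (suc m)} _ zero    = suc zero , (λ ())
  other {suc (suc m)} _ (suc c) = zero , (λ ())
  other {suc zero} (s≤s ()) zero
... | o , c≢o = first-step (proj₂ (connected c o))
  where
  first-step : ∀ {l} → Walk G c o l → Σ (Fin (order G)) λ b → adj G c b ≡ true
  first-step here       = ⊥-elim (c≢o refl)
  first-step (step e _) = _ , e

module UpperBound (T : Graph) (tree : IsTree T) (r : Fin (order T)) (k : ℕ) where
  open Walks T
  open Rooted T tree r

  Dominates : (V → Bool) → (V → Bool) → Set
  Dominates S P = ∀ y → P y ≡ true → Σ V λ s → S s ≡ true × Within s y k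

  Extremal : (V → Bool) → Set
  Extremal P = InducesTree T (λ v → P v ≡ true) (suc k) ⊎ InTk k T (λ v → P v ≡ true)

  record Cover (P : V → Bool) : Set where
    constructor mkCover
    field
      centres   : V → Bool
      dominates : Dominates centres P
      bound     : suc k * count centres ≤ count P
      tight     : suc k * count centres ≡ count P → Extremal P

  suc-k*count-singleton : ∀ (v : V) → suc k * count (singleton v) ≡ suc k
  suc-k*count-singleton v = trans (cong (suc k *_) (count-singleton v)) (*-identityʳ (suc k))

  module InductionStep (P : V → Bool) (closed : AncestorClosed P) (large : suc k ≤ count P)
              (induction : ∀ Q → count Q < count P → AncestorClosed Q → suc k ≤ count Q → Cover Q) where

    opaque
      x : V
      x = argmax depth r (InducedSubgraph.members T P)

      Px : P x ≡ true
      Px = argmax-all depth {P = λ v → P v ≡ true} (proj₁ closed)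
             (All.tabulate (λ {v} m → proj₂ (∈-filter⁻ (λ v → P v ≟ᵇ true) {xs = allFin (order T)} m)))

      x-deepest : ∀ y → P y ≡ true → depth y ≤ depth x
      x-deepest y Py = All.lookup (f[xs]≤f[argmax] r (InducedSubgraph.members T P))
                         (InducedSubgraph.∈-members T P y Py)

    shallow : depth x ≤ k → Cover P
    shallow depth≤k = mkCover (singleton r) dominated (subst (_≤ count P) (sym (suc-k*count-singleton r)) large) tight
      where
      dominated : Dominates (singleton r) P
      dominated y Py = r , ⌊≟⌋-true⁺ refl , within-mono (≤-trans (x-deepest y Py) depth≤k) (within-root y)
      tight : suc k * count (singleton r) ≡ count P → Extremal P
      tight e = inj₁ (subst (InducesTree T _) (trans (sym e) (suc-k*count-singleton r))
                  (InducedSubgraph.inducesTree T P acyclic connectedInside))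
        where
        connectedInside : InducedSubgraph.ConnectedInside T P
        connectedInside a b Pa Pb = TreePath.vertex a b , TreePath.len a b , TreePath.vertex-steps a b ,
                                    TreePath.vertex-0 a b , TreePath.vertex-len a b , AncestorClosed-vertex closed Pa Pb

    module Deep (k<depth : k < depth x) where

      u : V
      u = ancestor k x

      depth-u+k : depth u + k ≡ depth x
      depth-u+k = trans (cong (_+ k) (depth-ancestor k x)) (m∸n+n≡m (<⇒≤ k<depth))

      0<depth-u : 0 < depth u
      0<depth-u = subst (0 <_) (sym (depth-ancestor k x)) (m<n⇒0<n∸m k<depth)

      u≢r : ¬ u ≡ r
      u≢r = depth>0⇒≢root 0<depth-u

      w : V
      w = parent u

      u~w : u ~ w
      u~w = parent~ u≢r

      below : V → Bool
      below y = u ≼? y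

      Branch : V → Bool
      Branch y = P y ∧ below y

      Rest : V → Bool
      Rest y = P y ∧ not (below y)

      count-P : count P ≡ count Branch + count Rest
      count-P = count-split P below

      below⁺ : ∀ y t → t ≤ depth y → ancestor t y ≡ u → below y ≡ true
      below⁺ y t t≤d e = subst (λ v → v ≼? y ≡ true) e (≼?-ancestor y t t≤d)

      below⇒depth≥ : ∀ y → below y ≡ true → depth u ≤ depth y
      below⇒depth≥ y b with ≼?-true⁻ u y b
      ... | t , _ , e = subst (_≤ depth y) (trans (sym (depth-ancestor t y)) (cong depth e)) (m∸n≤m (depth y) t)

      below-root : below r ≡ false
      below-root = ¬-not (λ b → <⇒≱ 0<depth-u (subst (depth u ≤_) depth-root (below⇒depth≥ r b)))

      parent-below⇒below : ∀ y → below (parent y) ≡ true → below y ≡ true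
      parent-below⇒below y b with y ≟ r
      ... | yes y≡r = subst (λ v → below v ≡ true) (trans parent-root (sym y≡r)) (subst (λ v → below (parent v) ≡ true) y≡r b)
      ... | no  y≢r with ≼?-true⁻ u (parent y) b
      ... | t , t≤d , e = below⁺ y (t + 1) (subst (_≤ depth y) (+-comm 1 t) (subst (suc t ≤_) (sym (depth-parent y≢r)) (s≤s t≤d)))
                                          (trans (ancestor-+ t 1 y) e)

      below⇒parent-below : ∀ y → below y ≡ true → ¬ y ≡ u → below (parent y) ≡ true
      below⇒parent-below y b y≢u with ≼?-true⁻ u y b
      ... | zero  , _   , e = ⊥-elim (y≢u e)
      ... | suc t , t<d , e = below⁺ (parent y) t t≤d (begin
          ancestor t (parent y) ≡⟨ sym (ancestor-+ t 1 y) ⟩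
          ancestor (t + 1) y    ≡⟨ cong (λ q → ancestor q y) (+-comm t 1) ⟩
          ancestor (suc t) y    ≡⟨ e ⟩
          u                     ∎)
        where
        open ≡-Reasoning
        t≤d : t ≤ depth (parent y)
        t≤d = ≤-pred (subst (suc t ≤_) (depth-parent (depth>0⇒≢root (≤-trans (s≤s z≤n) t<d))) t<d)

      edge-leaving-below : ∀ b z → b ~ z → below b ≡ true → below z ≡ false → b ≡ u × z ≡ w
      edge-leaving-below b z b~z below-b below-z with edge⇒parent b~z
      ... | inj₂ parent-z≡b =
        ⊥-elim (false≢true (trans (sym below-z) (parent-below⇒below z (subst (λ v → below v ≡ true) (sym parent-z≡b) below-b))))
      ... | inj₁ parent-b≡z with b ≟ u
      ...   | yes b≡u = b≡u , trans (sym parent-b≡z) (cong parent b≡u)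
      ...   | no  b≢u =
        ⊥-elim (false≢true (trans (sym below-z) (subst (λ v → below v ≡ true) parent-b≡z (below⇒parent-below b below-b b≢u))))

      Branch-within-u : ∀ y → Branch y ≡ true → Within u y k
      Branch-within-u y By with ≼?-true⁻ u y (proj₂ (∧-true⁻ {P y} By))
      ... | t , t≤d , e = within-mono t≤k (within-sym (subst (λ v → Within y v t) e
                            (segment-within (λ s → ancestor s y) (depth y) (ancestor-steps y) 0 t z≤n t≤d)))
        where
        depth-u+t : depth u + t ≡ depth y
        depth-u+t = trans (cong (_+ t) (trans (cong depth (sym e)) (depth-ancestor t y))) (m∸n+n≡m t≤d)
        t≤k : t ≤ k
        t≤k = +-cancelˡ-≤ (depth u) t k (subst₂ _≤_ (sym depth-u+t) (sym depth-u+k) (x-deepest y (proj₁ (∧-true⁻ {P y} By))))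

      arm : ℕ → V
      arm t = ancestor (k ∸ t) x

      arm-steps : AdjacentSteps arm k
      arm-steps t t<k = ~-sym (subst (ancestor (k ∸ suc t) x ~_) (cong (λ q → ancestor q x) next)
                          (ancestor-steps x (k ∸ suc t) (≤-trans (subst (_≤ k) (sym next) (m∸n≤m k t)) (<⇒≤ k<depth))))
        where
        next : suc (k ∸ suc t) ≡ k ∸ t
        next = sym (+-∸-assoc 1 t<k)

      arm-injective : InjectiveUpTo arm k
      arm-injective s t s≤k t≤k e = ∸-cancelˡ-≡ s≤k t≤k
        (ancestor-injective x (k ∸ s) (k ∸ t) (≤-trans (m∸n≤m k s) (<⇒≤ k<depth)) (≤-trans (m∸n≤m k t) (<⇒≤ k<depth)) e)

      arm≡u⇒zero : ∀ (i : Fin (suc k)) → arm (toℕ i) ≡ u → i ≡ zero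
      arm≡u⇒zero i e = toℕ-injective (arm-injective (toℕ i) 0 (toℕ≤pred[n] i) z≤n e)

      Branch-ancestor-x : ∀ s → s ≤ k → Branch (ancestor s x) ≡ true
      Branch-ancestor-x s s≤k = ∧-true⁺ (AncestorClosed-ancestor closed s Px)
        (below⁺ (ancestor s x) (k ∸ s) (subst (k ∸ s ≤_) (sym (depth-ancestor s x)) (∸-monoˡ-≤ s (<⇒≤ k<depth)))
                (trans (sym (ancestor-+ (k ∸ s) s x)) (cong (λ q → ancestor q x) (m∸n+n≡m s≤k))))

      Branch-arm : ∀ t → Branch (arm t) ≡ true
      Branch-arm t = Branch-ancestor-x (k ∸ t) (m∸n≤m k t)

      below-arm : ∀ t → below (arm t) ≡ true
      below-arm t = proj₂ (∧-true⁻ {P (arm t)} (Branch-arm t))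

      private
        xToU : List V
        xToU = points (λ t → ancestor t x) k

        xToU-unique : Unique xToU
        xToU-unique = points-unique _ k (λ s t s≤k t≤k → ancestor-injective x s t (≤-trans s≤k (<⇒≤ k<depth)) (≤-trans t≤k (<⇒≤ k<depth)))

        xToU⊆Branch : ∀ y → y ∈ xToU → Branch y ≡ true
        xToU⊆Branch y m with ∈-points⁻ (λ t → ancestor t x) k m
        ... | t , t≤k , refl = Branch-ancestor-x t t≤k

      count-Branch≥ : suc k ≤ count Branch
      count-Branch≥ = subst (_≤ count Branch) (length-points (λ t → ancestor t x) k)
                        (Unique⇒length≤count Branch xToU xToU-unique xToU⊆Branch)

      Branch⊆arm : count Branch ≡ suc k → ∀ y → Branch y ≡ true → Σ ℕ λ t → t ≤ k × arm t ≡ y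
      Branch⊆arm count≡ y By with ∈-points⁻ (λ t → ancestor t x) k
           (count≤length⇒∈ Branch xToU xToU-unique xToU⊆Branch
             (≤-reflexive (trans count≡ (sym (length-points (λ t → ancestor t x) k)))) y By)
      ... | s , s≤k , e = k ∸ s , m∸n≤m k s , trans (cong (λ q → ancestor q x) (m∸[m∸n]≡n s≤k)) e

      Rest-closed : AncestorClosed Rest
      Rest-closed = ∧-true⁺ (proj₁ closed) (not-true⁺ below-root) , parent-in
        where
        parent-in : ∀ y → Rest y ≡ true → Rest (parent y) ≡ true
        parent-in y Ry with ∧-true⁻ {P y} Ry
        ... | Py , not-below = ∧-true⁺ (proj₂ closed y Py)
                                 (not-true⁺ (¬-not (λ b → false≢true (trans (sym (not-true⁻ not-below)) (parent-below⇒below y b)))))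

      Rest-w : Rest w ≡ true
      Rest-w = ∧-true⁺ (proj₂ closed u (AncestorClosed-ancestor closed k Px))
                 (not-true⁺ (¬-not (λ b → 1+n≰n (subst (_≤ depth w) (depth-parent u≢r) (below⇒depth≥ w b)))))

      Branch⊆P : ∀ y → Branch y ≡ true → P y ≡ true
      Branch⊆P y By = proj₁ (∧-true⁻ {P y} By)

      Rest⊆P : ∀ y → Rest y ≡ true → P y ≡ true
      Rest⊆P y Ry = proj₁ (∧-true⁻ {P y} Ry)

      not-below-Rest : ∀ y → Rest y ≡ true → below y ≡ false
      not-below-Rest y Ry = not-true⁻ (proj₂ (∧-true⁻ {P y} Ry))

      Branch-or-Rest : ∀ y → P y ≡ true → Branch y ≡ true ⊎ Rest y ≡ true
      Branch-or-Rest y Py = by (below y) refl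
        where
        by : ∀ b → below y ≡ b → Branch y ≡ true ⊎ Rest y ≡ true
        by true  e = inj₁ (∧-true⁺ Py e)
        by false e = inj₂ (∧-true⁺ Py (not-true⁺ e))

      Rest-within-w : ∀ y → Rest y ≡ true → Within w y (TreePath.len w y) × TreePath.len w y < count Rest
      Rest-within-w y Ry = TreePath.within w y , AncestorClosed-len<count Rest-closed Rest-w Ry

      count-P≥ : suc (suc k) ≤ count P
      count-P≥ = subst (suc (suc k) ≤_) (sym count-P) (subst (_≤ count Branch + count Rest) (+-comm (suc k) 1)
                   (+-mono-≤ count-Branch≥ (Unique⇒length≤count Rest (w ∷ []) ([] ∷ []) (λ { y (here refl) → Rest-w }))))

      count-Rest<count-P : count Rest < count P
      count-Rest<count-P = subst (count Rest <_) (sym count-P) (+-monoˡ-≤ (count Rest) (≤-trans (s≤s z≤n) count-Branch≥))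

      singleton-cover : ∀ v → Dominates (singleton v) P → Cover P
      singleton-cover v dominated = mkCover (singleton v) dominated (subst (_≤ count P) (sym (suc-k*count-singleton v)) large) never
        where
        never : suc k * count (singleton v) ≡ count P → Extremal P
        never e = ⊥-elim (1+n≰n (subst (suc (suc k) ≤_) (trans (sym e) (suc-k*count-singleton v)) count-P≥))

      module TwoArms (count-Branch≡ : count Branch ≡ suc k) (count-Rest≡ : count Rest ≡ suc k)
                     (y₀ : V) (Rest-y₀ : Rest y₀ ≡ true) (len≡k : TreePath.len w y₀ ≡ k) where

        leg : ℕ → V
        leg = TreePath.vertex w y₀

        leg-steps : AdjacentSteps leg k
        leg-steps = subst (AdjacentSteps leg) len≡k (TreePath.vertex-steps w y₀)

        leg-injective : InjectiveUpTo leg k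
        leg-injective = subst (InjectiveUpTo leg) len≡k (TreePath.vertex-injective w y₀)

        Rest-leg : ∀ t → Rest (leg t) ≡ true
        Rest-leg = AncestorClosed-vertex Rest-closed Rest-w Rest-y₀

        leg≡w⇒zero : ∀ (i : Fin (suc k)) → leg (toℕ i) ≡ w → i ≡ zero
        leg≡w⇒zero i e = toℕ-injective (leg-injective (toℕ i) 0 (toℕ≤pred[n] i) z≤n (trans e (sym (TreePath.vertex-0 w y₀))))

        Rest⊆leg : ∀ y → Rest y ≡ true → Σ ℕ λ t → t ≤ k × leg t ≡ y
        Rest⊆leg y Ry = ∈-points⁻ leg k (count≤length⇒∈ Rest (points leg k) (points-unique leg k leg-injective) onLeg
                          (≤-reflexive (trans count-Rest≡ (sym (length-points leg k)))) y Ry)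
          where
          onLeg : ∀ z → z ∈ points leg k → Rest z ≡ true
          onLeg z m with ∈-points⁻ leg k m
          ... | t , _ , refl = Rest-leg t

        embed : Fin 2 × Fin (suc k) → V
        embed (zero     , i) = leg (toℕ i)
        embed (suc zero , i) = arm (toℕ i)

        embed-injective : ∀ p q → embed p ≡ embed q → p ≡ q
        embed-injective (zero , i) (zero , j) e = cong (zero ,_) (toℕ-injective (leg-injective _ _ (toℕ≤pred[n] i) (toℕ≤pred[n] j) e))
        embed-injective (zero , i) (suc zero , j) e =
          ⊥-elim (false≢true (trans (sym (not-below-Rest _ (Rest-leg (toℕ i)))) (trans (cong below e) (below-arm (toℕ j)))))
        embed-injective (suc zero , i) (zero , j) e =
          ⊥-elim (false≢true (trans (sym (not-below-Rest _ (Rest-leg (toℕ j)))) (trans (cong below (sym e)) (below-arm (toℕ i)))))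
        embed-injective (suc zero , i) (suc zero , j) e = cong (suc zero ,_) (toℕ-injective (arm-injective _ _ (toℕ≤pred[n] i) (toℕ≤pred[n] j) e))

        P-embed : ∀ p → P (embed p) ≡ true
        P-embed (zero     , i) = Rest⊆P _ (Rest-leg (toℕ i))
        P-embed (suc zero , i) = Branch⊆P _ (Branch-arm (toℕ i))

        embed-onto : ∀ y → P y ≡ true → ∃ λ p → embed p ≡ y
        embed-onto y Py with Branch-or-Rest y Py
        ... | inj₁ By with Branch⊆arm count-Branch≡ y By
        ...   | t , t≤k , e = (suc zero , clamp k t) , trans (cong arm (toℕ-clamp k t t≤k)) e
        embed-onto y Py | inj₂ Ry with Rest⊆leg y Ry
        ...   | t , t≤k , e = (zero , clamp k t) , trans (cong leg (toℕ-clamp k t t≤k)) e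

        leg-arm-adj : ∀ i j → coronaAdj K₂ k (zero , i) (suc zero , j) ≡ adj T (leg (toℕ i)) (arm (toℕ j))
        leg-arm-adj i j = true⇔true⇒≡ corona⇒T T⇒corona
          where
          corona⇒T : coronaAdj K₂ k (zero , i) (suc zero , j) ≡ true → leg (toℕ i) ~ arm (toℕ j)
          corona⇒T e with Corona.coronaAdj-different K₂ k zero (suc zero) i j (λ ()) e
          ... | refl , refl = subst (_~ u) (sym (TreePath.vertex-0 w y₀)) (~-sym u~w)
          T⇒corona : leg (toℕ i) ~ arm (toℕ j) → coronaAdj K₂ k (zero , i) (suc zero , j) ≡ true
          T⇒corona e with edge-leaving-below _ _ (~-sym e) (below-arm (toℕ j)) (not-below-Rest _ (Rest-leg (toℕ i)))
          ... | arm≡u , leg≡w with arm≡u⇒zero j arm≡u | leg≡w⇒zero i leg≡w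
          ... | refl | refl = refl

        embed-adj : ∀ p q → coronaAdj K₂ k p q ≡ adj T (embed p) (embed q)
        embed-adj (zero , i) (zero , j) =
          trans (Corona.coronaAdj-same K₂ k zero i j)
                (sym (adj≡consecutive? acyclic leg k leg-steps leg-injective (toℕ i) (toℕ j) (toℕ≤pred[n] i) (toℕ≤pred[n] j)))
        embed-adj (zero , i) (suc zero , j) = leg-arm-adj i j
        embed-adj (suc zero , i) (zero , j) =
          trans (Corona.coronaAdj-sym K₂ k (suc zero , i) (zero , j)) (trans (leg-arm-adj j i) (adj-sym T _ _))
        embed-adj (suc zero , i) (suc zero , j) =
          trans (Corona.coronaAdj-same K₂ k (suc zero) i j)
                (sym (adj≡consecutive? acyclic arm k arm-steps arm-injective (toℕ i) (toℕ j) (toℕ≤pred[n] i) (toℕ≤pred[n] j)))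

        corona : InTk k T (λ v → P v ≡ true)
        corona = K₂ , ≤-refl , K₂-tree , embed , embed-injective , P-embed , embed-onto , embed-adj

      module ExtendCorona (count-Branch≡ : count Branch ≡ suc k) (S : Graph) (2≤S : 2 ≤ order S) (S-tree : IsTree S)
                          (iso : InducedIso (coronaAdj S k) T (λ v → Rest v ≡ true))
                          (c : Fin (order S)) (c↦w : proj₁ iso (c , zero) ≡ w) where

        open AddLeaf S c using () renaming (graph to S⁺)

        f : Corona.Vertex S k → V
        f = proj₁ iso

        f-injective : ∀ p q → f p ≡ f q → p ≡ q
        f-injective = proj₁ (proj₂ iso)

        Rest-f : ∀ p → Rest (f p) ≡ true
        Rest-f = proj₁ (proj₂ (proj₂ iso))

        embed : Corona.Vertex S⁺ k → V
        embed (zero  , i) = arm (toℕ i)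
        embed (suc a , i) = f (a , i)

        embed-injective : ∀ p q → embed p ≡ embed q → p ≡ q
        embed-injective (zero , i) (zero , j) e = cong (zero ,_) (toℕ-injective (arm-injective _ _ (toℕ≤pred[n] i) (toℕ≤pred[n] j) e))
        embed-injective (zero , i) (suc b , j) e =
          ⊥-elim (false≢true (trans (sym (not-below-Rest _ (Rest-f (b , j)))) (trans (cong below (sym e)) (below-arm (toℕ i)))))
        embed-injective (suc a , i) (zero , j) e =
          ⊥-elim (false≢true (trans (sym (not-below-Rest _ (Rest-f (a , i)))) (trans (cong below e) (below-arm (toℕ j)))))
        embed-injective (suc a , i) (suc b , j) e with f-injective (a , i) (b , j) e
        ... | refl = refl

        P-embed : ∀ p → P (embed p) ≡ true
        P-embed (zero  , i) = Branch⊆P _ (Branch-arm (toℕ i))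
        P-embed (suc a , i) = Rest⊆P _ (Rest-f (a , i))

        embed-onto : ∀ y → P y ≡ true → ∃ λ p → embed p ≡ y
        embed-onto y Py with Branch-or-Rest y Py
        ... | inj₁ By with Branch⊆arm count-Branch≡ y By
        ...   | t , t≤k , e = (zero , clamp k t) , trans (cong arm (toℕ-clamp k t t≤k)) e
        embed-onto y Py | inj₂ Ry with proj₁ (proj₂ (proj₂ (proj₂ iso))) y Ry
        ...   | (a , i) , e = (suc a , i) , e

        coronaAdj-lift : ∀ a b i j → coronaAdj S⁺ k (suc a , i) (suc b , j) ≡ coronaAdj S k (a , i) (b , j)
        coronaAdj-lift a b zero    zero    = refl
        coronaAdj-lift a b zero    (suc j) = cong (_∧ _) (⌊≟⌋-suc a b)
        coronaAdj-lift a b (suc i) zero    = cong (_∧ _) (⌊≟⌋-suc a b)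
        coronaAdj-lift a b (suc i) (suc j) = cong (_∧ _) (⌊≟⌋-suc a b)

        arm-f-adj : ∀ i a j → coronaAdj S⁺ k (zero , i) (suc a , j) ≡ adj T (arm (toℕ i)) (f (a , j))
        arm-f-adj i a j = true⇔true⇒≡ corona⇒T T⇒corona
          where
          corona⇒T : coronaAdj S⁺ k (zero , i) (suc a , j) ≡ true → arm (toℕ i) ~ f (a , j)
          corona⇒T e with Corona.coronaAdj-different S⁺ k zero (suc a) i j (λ ()) e
          ... | refl , refl = subst (λ q → u ~ f (q , zero)) (sym (⌊≟⌋-true⁻ e)) (subst (u ~_) (sym c↦w) u~w)
          T⇒corona : arm (toℕ i) ~ f (a , j) → coronaAdj S⁺ k (zero , i) (suc a , j) ≡ true
          T⇒corona e with edge-leaving-below _ _ e (below-arm (toℕ i)) (not-below-Rest _ (Rest-f (a , j)))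
          ... | arm≡u , f≡w with arm≡u⇒zero i arm≡u | f-injective (a , j) (c , zero) (trans f≡w (sym c↦w))
          ... | refl | refl = ⌊≟⌋-true⁺ refl

        embed-adj : ∀ p q → coronaAdj S⁺ k p q ≡ adj T (embed p) (embed q)
        embed-adj (zero , i) (zero , j) =
          trans (Corona.coronaAdj-same S⁺ k zero i j)
                (sym (adj≡consecutive? acyclic arm k arm-steps arm-injective (toℕ i) (toℕ j) (toℕ≤pred[n] i) (toℕ≤pred[n] j)))
        embed-adj (zero , i) (suc a , j) = arm-f-adj i a j
        embed-adj (suc a , i) (zero , j) =
          trans (Corona.coronaAdj-sym S⁺ k (suc a , i) (zero , j)) (trans (arm-f-adj j a i) (adj-sym T _ _))
        embed-adj (suc a , i) (suc b , j) = trans (coronaAdj-lift a b i j) (proj₂ (proj₂ (proj₂ (proj₂ iso))) (a , i) (b , j))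

        embedding : InducedIso (coronaAdj S⁺ k) T (λ v → P v ≡ true)
        embedding = embed , embed-injective , P-embed , embed-onto , embed-adj

        corona : InTk k T (λ v → P v ≡ true)
        corona = S⁺ , ≤-trans 2≤S (n≤1+n _) , (AddLeaf.connected S c (proj₁ S-tree) , corona-core-acyclic acyclic embedding) , embedding

      module RecentredCover (S : Graph) (2≤S : 2 ≤ order S) (S-tree : IsTree S)
                            (iso : InducedIso (coronaAdj S k) T (λ v → Rest v ≡ true))
                            (c : Fin (order S)) (i : Fin k) (c↦w : proj₁ iso (c , suc i) ≡ w) where

        f : Corona.Vertex S k → V
        f = proj₁ iso

        f-adj : ∀ p q → coronaAdj S k p q ≡ adj T (f p) (f q)
        f-adj = proj₂ (proj₂ (proj₂ (proj₂ iso)))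

        1≤k : 1 ≤ k
        1≤k = ≤-trans (s≤s z≤n) (toℕ≤pred[n] (suc i))

        c′ : Fin (order S)
        c′ = proj₁ (connected⇒neighbour (proj₁ S-tree) 2≤S c)

        c~c′ : adj S c c′ ≡ true
        c~c′ = proj₂ (connected⇒neighbour (proj₁ S-tree) 2≤S c)

        c′≢c : ¬ c′ ≡ c
        c′≢c e = Walks.~-irrefl S c~c′ (sym e)

        centre : Fin (order S) → V
        centre a = if ⌊ a ≟ c ⌋ then u else f (a , zero)

        centre-c : centre c ≡ u
        centre-c rewrite ⌊≟⌋-true⁺ (refl {x = c}) = refl

        centre-other : ∀ a → ¬ a ≡ c → centre a ≡ f (a , zero)
        centre-other a a≢c rewrite ⌊≟⌋-false⁺ a≢c = refl

        centres : V → Bool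
        centres v = ⌊ any? (λ a → centre a ≟ v) ⌋

        centres-centre : ∀ a → centres (centre a) ≡ true
        centres-centre a = ⌊≟⌋-true⁺′ (any? (λ b → centre b ≟ centre a)) (a , refl)
          where
          ⌊≟⌋-true⁺′ : ∀ {A : Set} (a? : Dec A) → A → ⌊ a? ⌋ ≡ true
          ⌊≟⌋-true⁺′ a? x = trans (isYes≗does a?) (dec-true a? x)

        count-centres≤ : count centres ≤ order S
        count-centres≤ = subst (count centres ≤_) (trans (length-map centre (allFin (order S))) (length-allFin (order S)))
                           (count≤length centres (map centre (allFin (order S))) image)
          where
          image : ∀ v → centres v ≡ true → v ∈ map centre (allFin (order S))
          image v e with any? (λ a → centre a ≟ v)
          ... | yes (a , refl) = ∈-map⁺ centre (∈-allFin a)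

        count-Rest≡ : count Rest ≡ order S * suc k
        count-Rest≡ = proj₂ (InTk⇒count≡ T (S , 2≤S , S-tree , iso))

        strict : suc k * count centres < count P
        strict = <-≤-trans (s≤s (subst (suc k * count centres ≤_) (trans (*-comm (suc k) (order S)) (sym count-Rest≡))
                                   (*-monoʳ-≤ (suc k) count-centres≤)))
                           count-Rest<count-P

        pendant : Fin (order S) → ℕ → V
        pendant a t = f (a , clamp k t)

        pendant-steps : ∀ a → AdjacentSteps (pendant a) k
        pendant-steps a t t<k = trans (sym (f-adj (a , clamp k t) (a , clamp k (suc t))))
          (trans (Corona.coronaAdj-same S k a (clamp k t) (clamp k (suc t)))
            (subst₂ (λ p q → consecutive? p q ≡ true) (sym (toℕ-clamp k t (<⇒≤ t<k))) (sym (toℕ-clamp k (suc t) t<k))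
              (consecutive?-true⁺ {t} (inj₁ refl))))

        pendant-within : ∀ a (s t : Fin (suc k)) → toℕ s ≤ toℕ t → Within (f (a , s)) (f (a , t)) (toℕ t ∸ toℕ s)
        pendant-within a s t s≤t = subst₂ (λ p q → Within p q (toℕ t ∸ toℕ s)) (at s) (at t)
                                     (segment-within (pendant a) k (pendant-steps a) (toℕ s) (toℕ t) s≤t (toℕ≤pred[n] t))
          where
          at : ∀ j → pendant a (toℕ j) ≡ f (a , j)
          at j = cong (λ q → f (a , q)) (clamp-toℕ k j)

        within-u-pendant-c : ∀ j → Within u (f (c , suc j)) k
        within-u-pendant-c j = subst (Within u (f (c , suc j))) (m+[n∸m]≡n 1≤k)
                                 (within-trans (within-edge ≤-refl u~w) (subst (λ v → Within v (f (c , suc j)) (k ∸ 1)) c↦w along))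
          where
          k∸1 : ∀ (l : Fin k) → toℕ l ≤ k ∸ 1
          k∸1 l = ≤-pred (≤-trans (toℕ≤pred[n] (suc l)) (≤-reflexive (sym (m+[n∸m]≡n 1≤k))))
          along : Within (f (c , suc i)) (f (c , suc j)) (k ∸ 1)
          along with toℕ i ≤? toℕ j
          ... | yes i≤j = within-mono (≤-trans (m∸n≤m (toℕ j) (toℕ i)) (k∸1 j)) (pendant-within c (suc i) (suc j) (s≤s i≤j))
          ... | no  i≰j = within-mono (≤-trans (m∸n≤m (toℕ i) (toℕ j)) (k∸1 i))
                            (within-sym (pendant-within c (suc j) (suc i) (s≤s (<⇒≤ (≰⇒> i≰j)))))

        dominated : Dominates centres P
        dominated y Py with Branch-or-Rest y Py
        ... | inj₁ By = u , subst (λ v → centres v ≡ true) centre-c (centres-centre c) , Branch-within-u y By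
        ... | inj₂ Ry with proj₁ (proj₂ (proj₂ (proj₂ iso))) y Ry
        ...   | (a , j) , refl with a ≟ c
        ...     | no a≢c = f (a , zero) , subst (λ v → centres v ≡ true) (centre-other a a≢c) (centres-centre a) ,
                           within-mono (toℕ≤pred[n] j) (pendant-within a zero j z≤n)
        dominated y Py | inj₂ Ry | (a , zero) , refl | yes refl =
          f (c′ , zero) , subst (λ v → centres v ≡ true) (centre-other c′ c′≢c) (centres-centre c′) ,
          within-edge 1≤k (trans (sym (f-adj (c′ , zero) (c , zero))) (trans (adj-sym S c′ c) c~c′))
        dominated y Py | inj₂ Ry | (a , suc j) , refl | yes refl =
          u , subst (λ v → centres v ≡ true) centre-c (centres-centre c) , within-u-pendant-c j

      centre-u : (∀ y → Rest y ≡ true → TreePath.len w y < k) → Cover P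
      centre-u short = singleton-cover u dominated
        where
        dominated : Dominates (singleton u) P
        dominated y Py with Branch-or-Rest y Py
        ... | inj₁ By = u , ⌊≟⌋-true⁺ refl , Branch-within-u y By
        ... | inj₂ Ry = u , ⌊≟⌋-true⁺ refl , within-mono (short y Ry)
                                               (within-trans (within-edge ≤-refl u~w) (proj₁ (Rest-within-w y Ry)))

      small-rest : count Rest ≤ k → Cover P
      small-rest count≤k = centre-u (λ y Ry → ≤-trans (proj₂ (Rest-within-w y Ry)) count≤k)

      module ExactRest (count-Rest≡ : count Rest ≡ suc k) where

        module Far (y₀ : V) (Ry₀ : Rest y₀ ≡ true) (k≤len : k ≤ TreePath.len w y₀) where

          centres : V → Bool
          centres v = singleton u v ∨ singleton w v

          dominated : Dominates centres P
          dominated y Py with Branch-or-Rest y Py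
          ... | inj₁ By = u , subst (λ b → b ∨ singleton w u ≡ true) (sym (⌊≟⌋-true⁺ refl)) refl , Branch-within-u y By
          ... | inj₂ Ry = w , trans (cong (singleton u w ∨_) (⌊≟⌋-true⁺ refl)) (∨-zeroʳ _) ,
                          within-mono (≤-pred (subst (TreePath.len w y <_) count-Rest≡ (proj₂ (Rest-within-w y Ry))))
                                      (proj₁ (Rest-within-w y Ry))

          twice : suc k * count centres ≤ suc k + suc k
          twice = subst (suc k * count centres ≤_) (trans (*-comm (suc k) 2) (cong (suc k +_) (+-identityʳ (suc k))))
                    (*-monoʳ-≤ (suc k) (subst (count centres ≤_) (cong₂ _+_ (count-singleton u) (count-singleton w))
                                          (count-∨ (singleton u) (singleton w))))

          bound : suc k * count centres ≤ count P
          bound = ≤-trans twice (subst (suc k + suc k ≤_) (sym count-P) (+-mono-≤ count-Branch≥ (≤-reflexive (sym count-Rest≡))))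

          tight : suc k * count centres ≡ count P → Extremal P
          tight e = inj₂ (TwoArms.corona count-Branch≡ count-Rest≡ y₀ Ry₀ len≡k)
            where
            count-Branch≡ : count Branch ≡ suc k
            count-Branch≡ = ≤-antisym (+-cancelʳ-≤ (suc k) (count Branch) (suc k)
                              (subst (_≤ suc k + suc k) (trans e (trans count-P (cong (count Branch +_) count-Rest≡))) twice))
                              count-Branch≥
            len≡k : TreePath.len w y₀ ≡ k
            len≡k = ≤-antisym (≤-pred (subst (TreePath.len w y₀ <_) count-Rest≡ (proj₂ (Rest-within-w y₀ Ry₀)))) k≤len

        cover : Cover P
        cover with any? (λ y → (Rest y ≟ᵇ true) ×-dec (k ≤? TreePath.len w y))
        ... | no  none                 = centre-u (λ y Ry → ≰⇒> (λ k≤len → none (y , Ry , k≤len)))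
        ... | yes (y₀ , Ry₀ , k≤len) = mkCover F.centres F.dominated F.bound F.tight
          where module F = Far y₀ Ry₀ k≤len

      module LargeRest (large-Rest : suc (suc k) ≤ count Rest) where

        rest : Cover Rest
        rest = induction Rest count-Rest<count-P Rest-closed (≤-trans (n≤1+n (suc k)) large-Rest)

        open Cover rest using () renaming (centres to centres′; dominates to dominates′; bound to bound′; tight to tight′)

        centres : V → Bool
        centres v = centres′ v ∨ singleton u v

        dominated : Dominates centres P
        dominated y Py with Branch-or-Rest y Py
        ... | inj₁ By = u , trans (cong (centres′ u ∨_) (⌊≟⌋-true⁺ refl)) (∨-zeroʳ _) , Branch-within-u y By
        ... | inj₂ Ry with dominates′ y Ry
        ...   | s , s∈ , within = s , subst (λ b → b ∨ singleton u s ≡ true) (sym s∈) refl , within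

        plus-one : suc k * count centres ≤ suc k * count centres′ + suc k
        plus-one = subst (suc k * count centres ≤_)
                     (trans (*-distribˡ-+ (suc k) (count centres′) 1) (cong (suc k * count centres′ +_) (*-identityʳ (suc k))))
                     (*-monoʳ-≤ (suc k) (subst (count centres ≤_) (cong (count centres′ +_) (count-singleton u))
                                          (count-∨ centres′ (singleton u))))

        bound : suc k * count centres ≤ count P
        bound = ≤-trans plus-one (subst (suc k * count centres′ + suc k ≤_) (trans (+-comm (count Rest) (count Branch)) (sym count-P))
                                    (+-mono-≤ bound′ count-Branch≥))

        both-tight : suc k * count centres ≡ count P → suc k * count centres′ ≡ count Rest × suc k ≡ count Branch
        both-tight e = +-squeeze bound′ count-Branch≥
                         (subst (_≤ suc k * count centres′ + suc k) (trans e (trans count-P (+-comm (count Branch) (count Rest)))) plus-one)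

        -- When the bound is attained, Rest is a corona; w is either a core vertex of it, and then P is a corona
        -- too, or w lies on a pendant path, and then recentring yields a strictly better cover.
        cover : Cover P
        cover with suc k * count centres ≟ℕ count P
        ... | no ≢ = mkCover centres dominated bound (⊥-elim ∘ ≢)
        ... | yes e with tight′ (proj₁ (both-tight e))
        ...   | inj₁ rest-tree = ⊥-elim (1+n≰n (subst (suc (suc k) ≤_) (InducesTree⇒count≡ T rest-tree) large-Rest))
        ...   | inj₂ (S , 2≤S , S-tree , iso) with proj₁ (proj₂ (proj₂ (proj₂ iso))) w Rest-w
        ...     | (c , zero) , c↦w =
          mkCover centres dominated bound (λ _ → inj₂ (ExtendCorona.corona (sym (proj₂ (both-tight e))) S 2≤S S-tree iso c c↦w))
        ...     | (c , suc i) , c↦w = mkCover R.centres R.dominated (<⇒≤ R.strict) (λ e → ⊥-elim (<⇒≢ R.strict e))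
          where module R = RecentredCover S 2≤S S-tree iso c i c↦w

    cover : Cover P
    cover with k <? depth x
    ... | no  k≮depth = shallow (≮⇒≥ k≮depth)
    ... | yes k<depth with <-cmp (count (Deep.Rest k<depth)) (suc k)
    ...   | tri< lt _ _ = Deep.small-rest k<depth (≤-pred lt)
    ...   | tri≈ _ eq _ = Deep.ExactRest.cover k<depth eq
    ...   | tri> _ _ gt = Deep.LargeRest.cover k<depth gt

  AncestorClosed⇒Cover : ∀ P → AncestorClosed P → suc k ≤ count P → Cover P
  AncestorClosed⇒Cover P = go (count P) P ≤-refl
    where
    go : ∀ N P → count P ≤ N → AncestorClosed P → suc k ≤ count P → Cover P
    go zero    P count≤0 _      large = ⊥-elim (<⇒≱ (≤-trans large count≤0) z≤n)
    go (suc N) P count≤N closed large =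
      InductionStep.cover P closed large (λ Q Q<P → go N Q (≤-pred (≤-trans Q<P count≤N)))

module CoronaLowerBound (T : Graph) (k : ℕ) (1≤k : 1 ≤ k) (S : Graph)
                        (iso : InducedIso (coronaAdj S k) T (NonLeaf T))
                        (D : Subset (order T)) (dominating : DistDominating T (suc k) D) where
  open Walks T

  f : Corona.Vertex S k → V
  f = proj₁ iso

  f-injective : ∀ p q → f p ≡ f q → p ≡ q
  f-injective = proj₁ (proj₂ iso)

  NonLeaf-f : ∀ p → NonLeaf T (f p)
  NonLeaf-f = proj₁ (proj₂ (proj₂ iso))

  f-onto : ∀ v → NonLeaf T v → ∃ λ p → f p ≡ v
  f-onto = proj₁ (proj₂ (proj₂ (proj₂ iso)))

  f-adj : ∀ p q → coronaAdj S k p q ≡ adj T (f p) (f q)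
  f-adj = proj₂ (proj₂ (proj₂ (proj₂ iso)))

  f~⇒same-pendant : ∀ {a b i j} → f (a , i) ~ f (b , j) → 1 ≤ toℕ i → a ≡ b × (suc (toℕ i) ≡ toℕ j ⊎ suc (toℕ j) ≡ toℕ i)
  f~⇒same-pendant {a} {b} {i} {j} e 1≤i with a ≟ b
  ... | no a≢b with () ← subst (λ q → 1 ≤ toℕ q) (proj₁ (Corona.coronaAdj-different S k a b i j a≢b (trans (f-adj _ _) e))) 1≤i
  ... | yes refl = refl , consecutive?-true⁻ (trans (sym (Corona.coronaAdj-same S k a i j)) (trans (f-adj _ _) e))

  tip : Fin (suc k)
  tip = clamp k k

  toℕ-tip : toℕ tip ≡ k
  toℕ-tip = toℕ-clamp k k ≤-refl

  nextToTip : Fin (suc k)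
  nextToTip = clamp k (k ∸ 1)

  toℕ-nextToTip : toℕ nextToTip ≡ k ∸ 1
  toℕ-nextToTip = toℕ-clamp k (k ∸ 1) (m∸n≤m k 1)

  1+[k∸1]≡k : suc (k ∸ 1) ≡ k
  1+[k∸1]≡k = m+[n∸m]≡n 1≤k

  tip~nextToTip : ∀ a → f (a , tip) ~ f (a , nextToTip)
  tip~nextToTip a = trans (sym (f-adj (a , tip) (a , nextToTip))) (trans (Corona.coronaAdj-same S k a tip nextToTip)
                      (subst₂ (λ p q → consecutive? p q ≡ true) (sym toℕ-tip) (sym toℕ-nextToTip)
                        (consecutive?-true⁺ {k} (inj₂ 1+[k∸1]≡k))))

  -- The tip of a pendant path has only one non-leaf neighbour, so, being a non-leaf itself, it carries a leaf.
  leafAt : ∀ a → Σ V λ b → f (a , tip) ~ b × IsLeaf T b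
  leafAt a with NonLeaf⇒other-neighbour (NonLeaf-f (a , tip)) (tip~nextToTip a)
  ... | b , b≢next , tip~b with deg T b ≟ℕ 1
  ...   | yes leaf = b , tip~b , leaf
  ...   | no nonLeaf with f-onto b nonLeaf
  ...     | (a′ , j) , refl with f~⇒same-pendant tip~b (subst (1 ≤_) (sym toℕ-tip) 1≤k)
  ...       | refl , inj₁ k+1≡j = ⊥-elim (1+n≰n (subst (_≤ k) (trans (sym k+1≡j) (cong suc toℕ-tip)) (toℕ≤pred[n] j)))
  ...       | refl , inj₂ j+1≡k = ⊥-elim (b≢next (cong (λ q → f (a , q))
                                    (toℕ-injective (trans (suc-injective (trans j+1≡k (trans toℕ-tip (sym 1+[k∸1]≡k)))) (sym toℕ-nextToTip)))))

  leaf : Fin (order S) → V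
  leaf a = proj₁ (leafAt a)

  leaf~tip : ∀ a → leaf a ~ f (a , tip)
  leaf~tip a = ~-sym (proj₁ (proj₂ (leafAt a)))

  leaf-IsLeaf : ∀ a → IsLeaf T (leaf a)
  leaf-IsLeaf a = proj₂ (proj₂ (leafAt a))

  Region : Fin (order S) → V → Set
  Region a z = (Σ (Fin (suc k)) λ j → f (a , j) ≡ z) ⊎ (Σ (Fin (suc k)) λ j → z ~ f (a , j) × IsLeaf T z)

  Region-disjoint : ∀ a b z → Region a z → Region b z → a ≡ b
  Region-disjoint a b z (inj₁ (i , fa)) (inj₁ (j , fb)) = cong proj₁ (f-injective (a , i) (b , j) (trans fa (sym fb)))
  Region-disjoint a b z (inj₁ (i , fa)) (inj₂ (_ , _ , leaf)) = ⊥-elim (NonLeaf-f (a , i) (subst (IsLeaf T) (sym fa) leaf))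
  Region-disjoint a b z (inj₂ (_ , _ , leaf)) (inj₁ (j , fb)) = ⊥-elim (NonLeaf-f (b , j) (subst (IsLeaf T) (sym fb) leaf))
  Region-disjoint a b z (inj₂ (i , z~a , leaf)) (inj₂ (j , z~b , _)) =
    cong proj₁ (f-injective (a , i) (b , j) (leaf-neighbour-unique leaf z~a z~b))

  -- From height at least q on the pendant path of a, q steps cannot reach the core of the corona.
  Confined : Fin (order S) → V → ℕ → Set
  Confined a z q = (Σ (Fin (suc k)) λ j → f (a , j) ≡ z × q ≤ toℕ j)
                 ⊎ (Σ (Fin (suc k)) λ j → 1 ≤ toℕ j × z ~ f (a , j) × IsLeaf T z × q ≤ suc (toℕ j))

  Confined⇒Region : ∀ a {z z′ l} → Walk T z z′ l → ∀ q → l ≤ q → Confined a z q → Region a z′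
  Confined⇒Region a here _ _ (inj₁ (j , fz , _))          = inj₁ (j , fz)
  Confined⇒Region a here _ _ (inj₂ (j , _ , z~ , leaf , _)) = inj₂ (j , z~ , leaf)
  Confined⇒Region a (step {w = z₁} {k = l} e w) q l<q (inj₁ (j , refl , q≤j)) with deg T z₁ ≟ℕ 1
  ... | yes leaf = Confined⇒Region a w (suc (toℕ j)) (≤-trans (≤-trans (n≤1+n l) l<q) (≤-trans q≤j (n≤1+n _)))
                     (inj₂ (j , ≤-trans (s≤s z≤n) (≤-trans l<q q≤j) , ~-sym e , leaf , ≤-refl))
  ... | no nonLeaf with f-onto z₁ nonLeaf
  ...   | (a′ , j′) , refl with f~⇒same-pendant e (≤-trans (s≤s z≤n) (≤-trans l<q q≤j))
  ...     | refl , inj₁ j+1≡j′ = Confined⇒Region a w l ≤-refl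
                                  (inj₁ (j′ , refl , subst (l ≤_) j+1≡j′ (≤-trans (≤-trans (n≤1+n l) (≤-trans l<q q≤j)) (n≤1+n _))))
  ...     | refl , inj₂ j′+1≡j = Confined⇒Region a w l ≤-refl
                                  (inj₁ (j′ , refl , ≤-pred (subst (suc l ≤_) (sym j′+1≡j) (≤-trans l<q q≤j))))
  Confined⇒Region a (step {k = l} e w) q l<q (inj₂ (j , _ , z~ , leaf , q≤j+1)) =
    Confined⇒Region a w l ≤-refl (inj₁ (j , sym (leaf-neighbour-unique leaf e z~) , ≤-pred (≤-trans l<q q≤j+1)))

  dominatorOf : ∀ a → Σ V λ s → s ∈ₛ D × Within (leaf a) s (suc k)
  dominatorOf a with leaf a ∈ₛ? D
  ... | yes leaf∈D = leaf a , leaf∈D , within-refl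
  ... | no  leaf∉D with dominating (leaf a) leaf∉D
  ...   | s , s∈D , j , j≤ , w = s , s∈D , (j , j≤ , reverseʷ w)

  dominator : Fin (order S) → V
  dominator a = proj₁ (dominatorOf a)

  dominator-Region : ∀ a → Region a (dominator a)
  dominator-Region a with proj₂ (proj₂ (dominatorOf a))
  ... | l , l≤ , w = Confined⇒Region a w (suc k) l≤
                       (inj₂ (tip , subst (1 ≤_) (sym toℕ-tip) 1≤k , leaf~tip a , leaf-IsLeaf a , s≤s (≤-reflexive (sym toℕ-tip))))

  dominator-injective : ∀ {a b} → dominator a ≡ dominator b → a ≡ b
  dominator-injective {a} {b} e = Region-disjoint a b (dominator a) (dominator-Region a) (subst (Region b) (sym e) (dominator-Region b))

  order≤∣D∣ : order S ≤ ∣ D ∣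
  order≤∣D∣ = subst₂ _≤_ (trans (length-map dominator (allFin (order S))) (length-allFin (order S))) (sym (∣S∣≡count D))
                (Unique⇒length≤count (Vec.lookup D) (map dominator (allFin (order S))) (map⁺ dominator-injective (allFin⁺ (order S))) inD)
    where
    inD : ∀ x → x ∈ map dominator (allFin (order S)) → Vec.lookup D x ≡ true
    inD x m with ∈-map⁻ dominator m
    ... | a , _ , refl = ∈ₛ⇒lookup≡true (proj₁ (proj₂ (dominatorOf a)))

module NonLeaves (T : Graph) (tree : IsTree T) where
  open Walks T

  nonLeaf? : V → Bool
  nonLeaf? v = not (deg T v ≡ᵇ 1)

  nonLeaf?-true⁻ : ∀ {v} → nonLeaf? v ≡ true → NonLeaf T v
  nonLeaf?-true⁻ e leaf = false≢true (trans (sym (not-true⁻ e)) (≡ᵇ-true⁺ leaf))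

  nonLeaf?-true⁺ : ∀ {v} → NonLeaf T v → nonLeaf? v ≡ true
  nonLeaf?-true⁺ nonLeaf = not-true⁺ (¬-not (nonLeaf ∘ ≡ᵇ-true⁻))

  nonLeaf?≡false⇒IsLeaf : ∀ {v} → nonLeaf? v ≡ false → IsLeaf T v
  nonLeaf?≡false⇒IsLeaf {v} e = ≡ᵇ-true⁻ (trans (sym (not-involutive (deg T v ≡ᵇ 1))) (cong not e))

  n∸ℓ≡count-nonLeaf : order T ∸ numLeaves T ≡ count nonLeaf?
  n∸ℓ≡count-nonLeaf = begin
    order T ∸ numLeaves T                         ≡⟨ cong (order T ∸_) (sum-indicator≡count isLeaf?) ⟩
    order T ∸ count isLeaf?                       ≡⟨ cong (_∸ count isLeaf?) (sym (count+count-not isLeaf?)) ⟩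
    count isLeaf? + count nonLeaf? ∸ count isLeaf? ≡⟨ m+n∸m≡n (count isLeaf?) (count nonLeaf?) ⟩
    count nonLeaf?                                ∎
    where
    open ≡-Reasoning
    isLeaf? : V → Bool
    isLeaf? v = deg T v ≡ᵇ 1

  some-nonLeaf : 1 ≤ count nonLeaf? → Σ V λ r → nonLeaf? r ≡ true
  some-nonLeaf 1≤count with any? (λ v → nonLeaf? v ≟ᵇ true)
  ... | yes found = found
  ... | no  none  = ⊥-elim (<⇒≱ 1≤count (count≤length nonLeaf? [] (λ y e → ⊥-elim (none (y , e)))))

  module _ (r : V) (nonLeaf-r : nonLeaf? r ≡ true) where
    open Rooted T tree r

    nonLeaf-AncestorClosed : AncestorClosed nonLeaf?
    nonLeaf-AncestorClosed = nonLeaf-r , parent-nonLeaf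
      where
      parent-nonLeaf : ∀ y → nonLeaf? y ≡ true → nonLeaf? (parent y) ≡ true
      parent-nonLeaf y nonLeaf-y with y ≟ r
      ... | yes refl = subst (λ v → nonLeaf? v ≡ true) (sym parent-root) nonLeaf-y
      ... | no  y≢r with parent y ≟ r
      ...   | yes p≡r = subst (λ v → nonLeaf? v ≡ true) (sym p≡r) nonLeaf-r
      ...   | no  p≢r = nonLeaf?-true⁺ (λ leaf → y≢grandparent (leaf-neighbour-unique leaf (~-sym (parent~ y≢r)) (parent~ p≢r)))
        where
        y≢grandparent : ¬ y ≡ parent (parent y)
        y≢grandparent e = 1+n≰n (≤-trans (n≤1+n _) (≤-reflexive (sym (trans (cong depth (sym e))
                            (trans (depth-parent y≢r) (cong suc (depth-parent p≢r)))))))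

    -- A leaf whose neighbour were also a leaf would make T a single edge, which has no non-leaf r.
    leaf-neighbour-nonLeaf : ∀ v → IsLeaf T v → Σ V λ y → v ~ y × nonLeaf? y ≡ true
    leaf-neighbour-nonLeaf v leaf-v with any? (λ y → adj T v y ≟ᵇ true)
    ... | no none = ⊥-elim (1+n≰n (subst (_≤ 0) (trans (sym (deg≡count v)) leaf-v)
                      (count≤length (adj T v) [] (λ y e → ⊥-elim (none (y , e))))))
    ... | yes (y , v~y) = y , v~y , by (nonLeaf? y) refl
      where
      by : ∀ b → nonLeaf? y ≡ b → nonLeaf? y ≡ true
      by true  e = e
      by false e = ⊥-elim (r∉edge (stuck (proj₂ (proj₁ tree v r)) (inj₁ refl)))
        where
        leaf-y : IsLeaf T y
        leaf-y = nonLeaf?≡false⇒IsLeaf e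
        stuck : ∀ {z t l} → Walk T z t l → (z ≡ v ⊎ z ≡ y) → (t ≡ v ⊎ t ≡ y)
        stuck here                      p = p
        stuck (step z~ w) (inj₁ refl) = stuck w (inj₂ (leaf-neighbour-unique leaf-v z~ v~y))
        stuck (step z~ w) (inj₂ refl) = stuck w (inj₁ (leaf-neighbour-unique leaf-y z~ (~-sym v~y)))
        r∉edge : r ≡ v ⊎ r ≡ y → ⊥
        r∉edge (inj₁ r≡v) = nonLeaf?-true⁻ (subst (λ q → nonLeaf? q ≡ true) r≡v nonLeaf-r) leaf-v
        r∉edge (inj₂ r≡y) = nonLeaf?-true⁻ (subst (λ q → nonLeaf? q ≡ true) r≡y nonLeaf-r) leaf-y

TreeOrCorona : ℕ → Graph → Set
TreeOrCorona d T = InducesTree T (NonLeaf T) d ⊎ InTk (d ∸ 1) T (NonLeaf T)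

module DistanceDomination (d : ℕ) (2≤d : 2 ≤ d) (T : Graph) (tree : IsTree T)
                          (d≤n∸ℓ : d ≤ order T ∸ numLeaves T) (γ : ℕ) (γ-spec : IsDistDomNumber T d γ) where
  open Walks T
  open NonLeaves T tree

  h : ℕ
  h = count nonLeaf?

  k : ℕ
  k = d ∸ 1

  1+k≡d : suc k ≡ d
  1+k≡d = m+[n∸m]≡n (≤-trans (s≤s z≤n) 2≤d)

  1≤k : 1 ≤ k
  1≤k = ∸-monoˡ-≤ 1 2≤d

  d≤h : d ≤ h
  d≤h = subst (d ≤_) n∸ℓ≡count-nonLeaf d≤n∸ℓ

  private
    root : Σ V λ r → nonLeaf? r ≡ true
    root = some-nonLeaf (≤-trans (≤-trans (s≤s z≤n) 2≤d) d≤h)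

  r : V
  r = proj₁ root

  open UpperBound T tree r k using (Cover; Extremal; AncestorClosed⇒Cover)

  nonLeafCover : Cover nonLeaf?
  nonLeafCover = AncestorClosed⇒Cover nonLeaf? (nonLeaf-AncestorClosed r (proj₂ root)) (subst (_≤ h) (sym 1+k≡d) d≤h)

  open Cover nonLeafCover

  dominating : DistDominating T d (Vec.tabulate centres)
  dominating v _ with nonLeaf? v in nl
  ... | true with dominates v nl
  ...   | s , s∈ , within = s , ∈ₛ-tabulate⁺ centres s∈ , within-mono (subst (k ≤_) 1+k≡d (n≤1+n k)) within
  dominating v _ | false with leaf-neighbour-nonLeaf r (proj₂ root) v (nonLeaf?≡false⇒IsLeaf nl)
  ...   | y , v~y , nonLeaf-y with dominates y nonLeaf-y
  ...     | s , s∈ , within = s , ∈ₛ-tabulate⁺ centres s∈ ,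
                              subst (Within s v) (trans (+-comm k 1) 1+k≡d) (within-trans within (within-edge ≤-refl (~-sym v~y)))

  γ≤count-centres : γ ≤ count centres
  γ≤count-centres = subst (γ ≤_) (∣tabulate∣≡count centres) (proj₂ γ-spec (Vec.tabulate centres) dominating)

  d*γ≤h : d * γ ≤ h
  d*γ≤h = ≤-trans (*-monoʳ-≤ d γ≤count-centres) (subst (λ q → q * count centres ≤ h) 1+k≡d bound)

  d*γ≡h⇒Extremal : d * γ ≡ h → Extremal nonLeaf?
  d*γ≡h⇒Extremal e = tight (≤-antisym bound (subst (λ q → h ≤ q * count centres) (sym 1+k≡d)
                                               (subst (_≤ d * count centres) e (*-monoʳ-≤ d γ≤count-centres))))

  private
    D = proj₁ (proj₁ γ-spec)
    D-dominating = proj₁ (proj₂ (proj₁ γ-spec))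
    ∣D∣≡γ = proj₂ (proj₂ (proj₁ γ-spec))

  1≤γ : 1 ≤ γ
  1≤γ = subst (1 ≤_) (trans (sym (∣S∣≡count D)) ∣D∣≡γ) (by (r ∈ₛ? D))
    where
    one : ∀ u → u ∈ₛ D → 1 ≤ count (Vec.lookup D)
    one u u∈D = Unique⇒length≤count (Vec.lookup D) (u ∷ []) ([] ∷ []) (λ { x (here refl) → ∈ₛ⇒lookup≡true u∈D })
    by : Dec (r ∈ₛ D) → 1 ≤ count (Vec.lookup D)
    by (yes r∈D) = one r r∈D
    by (no  r∉D) = one _ (proj₁ (proj₂ (D-dominating r r∉D)))

  toNonLeaf : ∀ {X : Set} {adjX : X → X → Bool} → InducedIso adjX T (λ v → nonLeaf? v ≡ true) → InducedIso adjX T (NonLeaf T)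
  toNonLeaf = InducedIso-cong {G = T} (λ _ → nonLeaf?-true⁻) (λ _ → nonLeaf?-true⁺)

  fromNonLeaf : ∀ {X : Set} {adjX : X → X → Bool} → InducedIso adjX T (NonLeaf T) → InducedIso adjX T (λ v → nonLeaf? v ≡ true)
  fromNonLeaf = InducedIso-cong {G = T} (λ _ → nonLeaf?-true⁺) (λ _ → nonLeaf?-true⁻)

  tree-lower : InducesTree T (NonLeaf T) d → h ≤ d * γ
  tree-lower (H , order≡d , H-tree , iso) =
    subst (_≤ d * γ) (sym (InducesTree⇒count≡ T (H , order≡d , H-tree , fromNonLeaf iso)))
      (subst (_≤ d * γ) (*-identityʳ d) (*-monoʳ-≤ d 1≤γ))

  corona-lower : InTk k T (NonLeaf T) → h ≤ d * γ
  corona-lower (S , 2≤S , S-tree , iso) = begin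
    h                ≡⟨ proj₂ (InTk⇒count≡ T (S , 2≤S , S-tree , fromNonLeaf iso)) ⟩
    order S * suc k  ≡⟨ cong (order S *_) 1+k≡d ⟩
    order S * d      ≤⟨ *-monoˡ-≤ d (subst (order S ≤_) ∣D∣≡γ lower) ⟩
    γ * d            ≡⟨ *-comm γ d ⟩
    d * γ            ∎
    where
    open ≤-Reasoning
    lower : order S ≤ ∣ D ∣
    lower = CoronaLowerBound.order≤∣D∣ T k 1≤k S iso D (subst (λ q → DistDominating T q D) (sym 1+k≡d) D-dominating)

  equality⇔TreeOrCorona : d * γ ≡ order T ∸ numLeaves T ⇔ TreeOrCorona d T
  equality⇔TreeOrCorona = mk⇔ to from
    where
    to : d * γ ≡ order T ∸ numLeaves T → TreeOrCorona d T
    to e with d*γ≡h⇒Extremal (trans e n∸ℓ≡count-nonLeaf)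
    ... | inj₁ (H , order≡ , H-tree , iso) = inj₁ (H , trans order≡ 1+k≡d , H-tree , toNonLeaf iso)
    ... | inj₂ (S , 2≤S , S-tree , iso)    = inj₂ (S , 2≤S , S-tree , toNonLeaf iso)
    from : TreeOrCorona d T → d * γ ≡ order T ∸ numLeaves T
    from extremal = trans (≤-antisym d*γ≤h (lower extremal)) (sym n∸ℓ≡count-nonLeaf)
      where
      lower : TreeOrCorona d T → h ≤ d * γ
      lower (inj₁ t) = tree-lower t
      lower (inj₂ c) = corona-lower c

InFd'⇔TreeOrCorona : ∀ d T → 2 ≤ d → InFd' d T ⇔ TreeOrCorona d T
InFd'⇔TreeOrCorona 2                   T _ = mk⇔ to from
  where
  to : InFd' 2 T → TreeOrCorona 2 T
  to (inj₁ iso)    = inj₁ (K₂ , refl , K₂-tree , iso)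
  to (inj₂ corona) = inj₂ corona
  from : TreeOrCorona 2 T → InFd' 2 T
  from (inj₁ tree)   = inj₁ (InducesTree-2⇒K₂ {G = T} tree)
  from (inj₂ corona) = inj₂ corona
InFd'⇔TreeOrCorona (suc (suc (suc d))) T _ = mk⇔ (λ x → x) (λ x → x)
InFd'⇔TreeOrCorona 1 T (s≤s ())

corollary4p3 : (d : ℕ) → 2 ≤ d → (T : Graph) → IsTree T →
    d ≤ order T ∸ numLeaves T →
    (γ : ℕ) → IsDistDomNumber T d γ →
    (d * γ ≤ order T ∸ numLeaves T) × ((d * γ ≡ order T ∸ numLeaves T) ⇔ InFd' d T)
corollary4p3 d 2≤d T tree d≤n∸ℓ γ γ-spec =
  subst (d * γ ≤_) (sym n∸ℓ≡count-nonLeaf) d*γ≤h ,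
  Function.Properties.Equivalence.sym (InFd'⇔TreeOrCorona d T 2≤d) ⇔-∘ equality⇔TreeOrCorona
  where
  open DistanceDomination d 2≤d T tree d≤n∸ℓ γ γ-spec
  open NonLeaves T tree using (n∸ℓ≡count-nonLeaf)
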